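{- Let $p \geq 1$ and $s_1, s_2 \geq 1$ be integers. Let $b_n = b_n^{(s_1)}$ ($n \geq -2$) be the sequence defined by $b_n = b_{n-1} + b_{n-2}$ for $n \geq 0$, with $b_{ -2} = 2^{s_1}$ and $b_{ -1} = 2^{s_1-1}(s_1+2)$. Define $$t(p,s_1,s_2) := 2^{s_2-1}\left(2b_{2p-3}^{(s_1)} + s_2\, b_{2p-4}^{(s_1)}\right).$$ Then the number of spanning trees of the cone over the bi-coconut tree $T(p,s_1,s_2)$ is $$\tau(\mathrm{Cone}(T(p,s_1,s_2))) = t(p,s_1,s_2).$$
   Context: For a graph $G$ on vertex set $\{v_1,\dots,v_n\}$, the cone $\mathrm{Cone}(G)$ is obtained by adding a new vertex $v_0$ and one edge $\{v_0,v_i\}$ for each $i=1,\dots,n$. For positive integers $p, s_1, s_2$, the bi-coconut tree $T(p,s_1,s_2)$ is obtained from a path on $p$ vertices $\pi_1,\dots,\pi_p$ by attaching $s_1$ new leaf vertices to the endvertex $\pi_1$ and $s_2$ new leaf vertices to the endvertex $\pi_p$ (when $p=1$, all $s_1+s_2$ leaves are attached to the single path vertex). $\tau(G)$ denotes the number of spanning trees of $G$. -}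

module Defs where

open import Data.Nat using (ℕ; zero; suc; _+_; _*_; _∸_; _^_; _≤_; s≤s)
open import Data.Fin using (Fin; zero; suc; _↑ˡ_; _↑ʳ_; inject₁; fromℕ)
open import Data.Fin.Subset using (Subset; _∈_)
open import Data.Vec using ([]; _∷_)
open import Data.Bool using (true; false)
open import Data.List using (List; []; _∷_; _++_; [_]; map; allFin; length; lookup; filter)
open import Data.List.Relation.Unary.Linked using (Linked)
open import Data.List.Relation.Unary.Unique.Propositional using (Unique)
open import Data.Product using (_×_; _,_; ∃; ∃-syntax)
open import Data.Sum using (_⊎_)
open import Relation.Binary.PropositionalEquality using (_≡_)
open import Relation.Binary.Construct.Closure.ReflexiveTransitive using (Star)
open import Relation.Nullary using (¬_)
open import Relation.Unary using (Decidable)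

-- Finite simple graphs on vertex set Fin n, given by their list of edges
-- (each edge listed once, as an unordered pair written (u , v)).

Graph : ℕ → Set
Graph n = List (Fin n × Fin n)

EdgeSet : ∀ {n} → Graph n → Set
EdgeSet G = Subset (length G)

Adj : ∀ {n} (G : Graph n) → EdgeSet G → Fin n → Fin n → Set
Adj G S u v = ∃[ i ] (i ∈ S × (lookup G i ≡ (u , v) ⊎ lookup G i ≡ (v , u)))

Connected : ∀ {n} (G : Graph n) → EdgeSet G → Set
Connected G S = ∀ u v → Star (Adj G S) u v

HasCycle : ∀ {n} (G : Graph n) → EdgeSet G → Set
HasCycle {n} G S =
  ∃[ x ] ∃[ ys ] (2 ≤ length ys × Unique (x ∷ ys) × Linked (Adj G S) (x ∷ ys ++ [ x ]))

IsSpanningTree : ∀ {n} (G : Graph n) → EdgeSet G → Set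
IsSpanningTree G S = Connected G S × ¬ HasCycle G S

allSubsets : (m : ℕ) → List (Subset m)
allSubsets zero = [] ∷ []
allSubsets (suc m) = map (true ∷_) (allSubsets m) ++ map (false ∷_) (allSubsets m)

-- τ(G): the number of spanning trees of G (counted through any decision
-- procedure for IsSpanningTree; the count does not depend on the choice).
τ : ∀ {n} (G : Graph n) → Decidable (IsSpanningTree G) → ℕ
τ G dec = length (filter dec (allSubsets (length G)))

Cone : ∀ {n} → Graph n → Graph (suc n)
Cone {n} G = map (λ { (u , v) → suc u , suc v }) G ++ map (λ v → zero , suc v) (allFin n)

-- Bi-coconut tree T(p, s₁, s₂) on vertex set Fin (p + s₁ + s₂):
-- path vertices π₁..π_p are the first p vertices, then the s₁ leaves
-- attached to π₁, then the s₂ leaves attached to π_p.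

BiCoconut : (p s₁ s₂ : ℕ) → 1 ≤ p → Graph (p + s₁ + s₂)
BiCoconut (suc q) s₁ s₂ (s≤s _) = pathEdges ++ leaves₁ ++ leaves₂
  where
  π : Fin (suc q) → Fin (suc q + s₁ + s₂)
  π i = (i ↑ˡ s₁) ↑ˡ s₂
  pathEdges = map (λ i → π (inject₁ i) , π (suc i)) (allFin q)
  leaves₁ = map (λ j → π zero , ((suc q ↑ʳ j) ↑ˡ s₂)) (allFin s₁)
  leaves₂ = map (λ j → π (fromℕ q) , (suc q + s₁) ↑ʳ j) (allFin s₂)

-- The sequence b^{(s₁)}_n (n ≥ -2), shifted: bShift s₁ k = b^{(s₁)}_{k-2}.

bShift : ℕ → ℕ → ℕ
bShift s₁ zero = 2 ^ s₁
bShift s₁ (suc zero) = 2 ^ (s₁ ∸ 1) * (s₁ + 2)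
bShift s₁ (suc (suc k)) = bShift s₁ (suc k) + bShift s₁ k

-- t(p, s₁, s₂) = 2^{s₂-1} (2 b_{2p-3} + s₂ b_{2p-4}),
-- with b_{2p-3} = bShift (2p-1), b_{2p-4} = bShift (2p-2).
t : ℕ → ℕ → ℕ → ℕ
t p s₁ s₂ = 2 ^ (s₂ ∸ 1) * (2 * bShift s₁ (2 * p ∸ 1) + s₂ * bShift s₁ (2 * p ∸ 2))

{-# OPTIONS --safe #-}
-- A spanning subgraph of the cone over a forest is a spanning tree exactly when every
-- component of its forest part receives exactly one apex edge.  In the bi-coconut tree the
-- forest part consists of path segments, with each leaf either hanging off its end of the path
-- or isolated.  Giving path vertex i the weight "apex edge at i, plus the number of leaves at i
-- joined both to i and to the apex", the condition says: every leaf is joined to its hub or to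
-- the apex, and every path segment has total weight one.  At most one leaf per end may be joined
-- to both, which produces the factors 2^s and s·2^(s-1).  Scanning the path edge by edge, the
-- numbers u, w of admissible configurations with end weight 0 resp. 1 evolve by
-- (u, w) ↦ (2u + w, u + w), the square of the Fibonacci step that defines b.

module Submission where

open import Defs using (IsSpanningTree; Cone; BiCoconut; τ; t)
open import Data.Nat using (ℕ; _≤_; suc; z≤n; s≤s)
open import Function using (_∘_)
open import Relation.Binary.PropositionalEquality using (_≡_; module ≡-Reasoning)
open import Relation.Unary using (Decidable)
open import Relation.Binary.Definitions using (DecidableEquality)
open import Data.Fin using (Fin)
open import Data.Bool using (Bool)

module Walks where

  open import Data.Nat using (ℕ; suc; _≤_; _<_; z≤n; s≤s)
  open import Data.Nat.Properties using (<⇒≱)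
  open import Data.List using (List; []; _∷_; _++_; [_]; map; length)
  open import Data.List.Properties using (map-++; length-map; length-++-sucʳ; length-++-comm; ++-assoc)
  open import Data.List.Extrema.Nat using (argmax; argmax-sel; f[⊥]≤f[argmax]; f[xs]≤f[argmax])
  open import Data.List.Relation.Unary.Linked as Linked using (Linked; []; [-]; _∷_)
  import Data.List.Relation.Unary.Linked.Properties as Linked
  open import Data.List.Relation.Unary.All as All using (All; []; _∷_)
  open import Data.List.Relation.Unary.All.Properties using (All-swap; ++⁻)
  open import Data.List.Relation.Unary.AllPairs as AllPairs using ([]; _∷_)
  import Data.List.Relation.Unary.AllPairs.Properties as AllPairs
  open import Data.List.Relation.Unary.Any using (here; there)
  open import Data.List.Relation.Unary.Unique.Propositional using (Unique)
  import Data.List.Relation.Unary.Unique.Propositional.Properties as Unique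
  open import Data.List.Membership.Propositional using (_∈_; _∉_)
  open import Data.List.Membership.Propositional.Properties using (∈-∃++; ∈-++⁺ˡ; ∈-++⁺ʳ; ∈-++⁻)
  open import Data.List.Relation.Binary.Subset.Propositional using (_⊆_)
  import Data.List.Membership.DecPropositional as DecMembership
  open import Data.Product using (∃-syntax; _×_; _,_; proj₁; proj₂)
  open import Data.Sum using (_⊎_; inj₁; inj₂)
  open import Data.Empty using (⊥-elim)
  open import Relation.Nullary using (¬_; yes; no)
  open import Relation.Binary.Definitions using (DecidableEquality)
  open import Relation.Binary.PropositionalEquality
    using (_≡_; _≢_; refl; sym; trans; cong; subst; subst₂; ≢-sym)
  open import Relation.Binary.Construct.Closure.ReflexiveTransitive using (Star; ε; _◅_)

  module _ {A : Set} (R : A → A → Set) where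

    Cycle : A → List A → Set
    Cycle x ys = 2 ≤ length ys × Unique (x ∷ ys) × Linked R (x ∷ ys ++ [ x ])

    Cyclic : Set
    Cyclic = ∃[ x ] ∃[ ys ] Cycle x ys

    IsTree : Set
    IsTree = (∀ u v → Star R u v) × ¬ Cyclic

  module _ {A : Set} where

    unique-++⁻ : ∀ (xs : List A) {ys} → Unique (xs ++ ys) →
                 Unique xs × Unique ys × All (λ x → All (x ≢_) ys) xs
    unique-++⁻ [] u = [] , u , []
    unique-++⁻ (x ∷ xs) (x∉ ∷ u) with ++⁻ xs x∉ | unique-++⁻ xs u
    ... | x∉xs , x∉ys | uxs , uys , disjoint = x∉xs ∷ uxs , uys , x∉ys ∷ disjoint

    unique-++-comm : ∀ (xs : List A) {ys} → Unique (xs ++ ys) → Unique (ys ++ xs)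
    unique-++-comm xs u with unique-++⁻ xs u
    ... | uxs , uys , disjoint =
      AllPairs.++⁺ uys uxs (All.map (All.map ≢-sym) (All-swap disjoint))

    ∈-last : ∀ (xs : List A) y → y ∈ xs ++ [ y ]
    ∈-last [] y = here refl
    ∈-last (x ∷ xs) y = there (∈-last xs y)

    snocView : ∀ (x : A) xs → ∃[ ys ] ∃[ y ] (x ∷ xs ≡ ys ++ [ y ])
    snocView x [] = [] , x , refl
    snocView x (x′ ∷ xs) with snocView x′ xs
    ... | ys , y , eq = x ∷ ys , y , cong (x ∷_) eq

  module _ {A : Set} {R : A → A → Set} where

    linked-split : ∀ (xs : List A) {y zs} → Linked R (xs ++ y ∷ zs) →
                   Linked R (xs ++ [ y ]) × Linked R (y ∷ zs)
    linked-split [] l = [-] , l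
    linked-split (x ∷ []) (r ∷ l) = r ∷ [-] , l
    linked-split (x ∷ x′ ∷ xs) (r ∷ l) with linked-split (x′ ∷ xs) l
    ... | l₁ , l₂ = r ∷ l₁ , l₂

    linked-join : ∀ (xs : List A) {y zs} → Linked R (xs ++ [ y ]) → Linked R (y ∷ zs) →
                  Linked R (xs ++ y ∷ zs)
    linked-join [] _ l = l
    linked-join (x ∷ []) (r ∷ [-]) l = r ∷ l
    linked-join (x ∷ x′ ∷ xs) (r ∷ l₁) l = r ∷ linked-join (x′ ∷ xs) l₁ l

    linked⇒star : ∀ x (xs : List A) y → Linked R (x ∷ xs ++ [ y ]) → Star R x y
    linked⇒star x [] y (r ∷ [-]) = r ◅ ε
    linked⇒star x (x′ ∷ xs) y (r ∷ l) = r ◅ linked⇒star x′ xs y l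

    linked-mapWith-All : ∀ {S : A → A → Set} {P : A → Set} →
                         (∀ {u v} → P u → P v → R u v → S u v) →
                         ∀ {xs} → All P xs → Linked R xs → Linked S xs
    linked-mapWith-All f _ [] = []
    linked-mapWith-All f _ [-] = [-]
    linked-mapWith-All f (pu ∷ pv ∷ ps) (r ∷ l) = f pu pv r ∷ linked-mapWith-All f (pv ∷ ps) l

    rotate : ∀ {x ys z} → Cycle R x ys → z ∈ x ∷ ys →
             ∃[ zs ] (Cycle R z zs × zs ⊆ x ∷ ys)
    rotate {ys = ys} c (here refl) = ys , c , there
    rotate {x} {ys} {z} (len , u , l) (there z∈ys) with ∈-∃++ z∈ys
    ... | ys₁ , ys₂ , refl = ys₂ ++ x ∷ ys₁ , (len′ , u′ , l′) , sub
      where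
      halves = linked-split (x ∷ ys₁)
                 (subst (Linked R) (cong (x ∷_) (++-assoc ys₁ (z ∷ ys₂) [ x ])) l)
      l′ : Linked R (z ∷ (ys₂ ++ x ∷ ys₁) ++ [ z ])
      l′ = subst (Linked R) (cong (z ∷_) (sym (++-assoc ys₂ (x ∷ ys₁) [ z ])))
             (linked-join (z ∷ ys₂) (proj₂ halves) (proj₁ halves))
      u′ : Unique (z ∷ ys₂ ++ x ∷ ys₁)
      u′ = unique-++-comm (x ∷ ys₁) u
      len′ : 2 ≤ length (ys₂ ++ x ∷ ys₁)
      len′ = subst (2 ≤_) (trans (length-++-sucʳ ys₁ z ys₂)
               (trans (cong suc (length-++-comm ys₁ ys₂)) (sym (length-++-sucʳ ys₂ x ys₁)))) len
      sub : ys₂ ++ x ∷ ys₁ ⊆ x ∷ ys₁ ++ z ∷ ys₂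
      sub m with ∈-++⁻ ys₂ m
      ... | inj₁ m₂ = there (∈-++⁺ʳ ys₁ (there m₂))
      ... | inj₂ (here e) = here e
      ... | inj₂ (there m₁) = there (∈-++⁺ˡ m₁)

    record Through (x : A) (ys : List A) : Set where
      field
        first last : A
        middle : List A
        shape : ys ≡ first ∷ middle ++ [ last ]
        enter : R x first
        leave : R last x
        first≢last : first ≢ last
        walk : Linked R (first ∷ middle ++ [ last ])
        x∉ys : x ∉ ys

    through : ∀ {x ys} → Cycle R x ys → Through x ys
    through {x} {y ∷ y′ ∷ ys} (s≤s (s≤s z≤n) , x∉ ∷ y∉ ∷ _ , r ∷ l) with snocView y′ ys
    ... | mid , z , eq = record
      { first = y ; last = z ; middle = mid ; shape = cong (y ∷_) eq
      ; enter = r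
      ; leave = Linked.head (proj₂ halves)
      ; first≢last = λ y≡z → All.lookup y∉ (subst (_∈ y′ ∷ ys) (sym y≡z)
                                             (subst (z ∈_) (sym eq) (∈-last mid z))) refl
      ; walk = proj₁ halves
      ; x∉ys = λ m → All.lookup x∉ m refl }
      where
      halves = linked-split (y ∷ mid)
                 (subst (Linked R) (cong (y ∷_) (++-assoc mid [ z ] [ x ]))
                   (subst (λ w → Linked R (y ∷ w ++ [ x ])) eq l))

    module _ (_≟_ : DecidableEquality A) where
      open DecMembership _≟_ using (_∈?_)

      simplePath : ∀ {a b} → Star R a b → a ≢ b →
                   ∃[ l ] (Linked R (a ∷ l ++ [ b ]) × Unique (a ∷ l ++ [ b ]))
      simplePath ε a≢b = ⊥-elim (a≢b refl)
      simplePath {a} {b} (_◅_ {j = w} r rest) a≢b with w ≟ b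
      ... | yes refl = [] , r ∷ [-] , (a≢b ∷ []) ∷ [] ∷ []
      ... | no w≢b with simplePath rest w≢b
      ...   | l , lk , un with a ∈? (w ∷ l)
      ...     | no a∉ = w ∷ l , r ∷ lk , All.tabulate (λ m e → a∉′ (subst (_∈ _) (sym e) m)) ∷ un
        where
        a∉′ : a ∉ w ∷ l ++ [ b ]
        a∉′ m with ∈-++⁻ (w ∷ l) m
        ... | inj₁ m₁ = a∉ m₁
        ... | inj₂ (here e) = a≢b e
      ...     | yes a∈ with ∈-∃++ a∈
      ...       | P , Q , eq = Q , proj₂ (linked-split P (subst (Linked R) eq′ lk)) ,
                               proj₁ (proj₂ (unique-++⁻ P (subst Unique eq′ un)))
        where
        eq′ : w ∷ l ++ [ b ] ≡ P ++ a ∷ (Q ++ [ b ])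
        eq′ = trans (cong (_++ [ b ]) eq) (++-assoc P (a ∷ Q) [ b ])

  module _ {A B : Set} {R : A → A → Set} {S : B → B → Set}
           (f : A → B) (g : B → A) (f∘g≗id : ∀ b → f (g b) ≡ b)
           (f-hom : ∀ {u v} → R u v → S (f u) (f v))
           (g-hom : ∀ {u v} → S u v → R (g u) (g v)) where

    IsTree-transport : IsTree R → IsTree S
    IsTree-transport (conn , acyc) = conn′ , acyc′
      where
      star-map : ∀ {u v} → Star R u v → Star S (f u) (f v)
      star-map ε = ε
      star-map (r ◅ s) = f-hom r ◅ star-map s

      g-injective : ∀ {u v} → g u ≡ g v → u ≡ v
      g-injective {u} {v} e = trans (sym (f∘g≗id u)) (trans (cong f e) (f∘g≗id v))

      conn′ : ∀ u v → Star S u v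
      conn′ u v = subst₂ (Star S) (f∘g≗id u) (f∘g≗id v) (star-map (conn (g u) (g v)))

      acyc′ : ¬ Cyclic S
      acyc′ (x , ys , len , u , l) =
        acyc (g x , map g ys ,
              subst (2 ≤_) (sym (length-map g ys)) len ,
              Unique.map⁺ g-injective u ,
              subst (Linked R) (cong (g x ∷_) (map-++ g ys [ x ]))
                (Linked.map⁺ (Linked.map g-hom l)))

  module _ {A : Set} {R : A → A → Set} (parent : A → A) (depth : A → ℕ)
           (edge-to-parent : ∀ {u w} → R u w →
                             (w ≡ parent u × depth w < depth u) ⊎ (u ≡ parent w × depth u < depth w)) where

    deepest : ∀ (x : A) xs → ∃[ m ] (m ∈ x ∷ xs × ∀ {z} → z ∈ x ∷ xs → depth z ≤ depth m)
    deepest x xs = argmax depth x xs , selected (argmax-sel depth x xs) , bound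
      where
      selected : argmax depth x xs ≡ x ⊎ argmax depth x xs ∈ xs → argmax depth x xs ∈ x ∷ xs
      selected (inj₁ e) = here e
      selected (inj₂ m) = there m
      bound : ∀ {z} → z ∈ x ∷ xs → depth z ≤ depth (argmax depth x xs)
      bound (here refl) = f[⊥]≤f[argmax] {f = depth} x xs
      bound (there m) = All.lookup (f[xs]≤f[argmax] {f = depth} x xs) m

    -- Both cycle-neighbours of a deepest vertex of a cycle would have to be its parent.
    parent⇒acyclic : ¬ Cyclic R
    parent⇒acyclic (x , ys , c) with deepest x ys
    ... | m , m∈ , maximal with rotate c m∈
    ...   | zs , c′ , zs⊆ with through c′
    ...     | record { first = a ; last = b ; middle = mid ; shape = shape
                     ; enter = m→a ; leave = b→m ; first≢last = a≢b } =
      a≢b (trans (toParent (inj₁ m→a) a∈) (sym (toParent (inj₂ b→m) b∈)))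
      where
      a∈ : a ∈ zs
      a∈ = subst (a ∈_) (sym shape) (here refl)
      b∈ : b ∈ zs
      b∈ = subst (b ∈_) (sym shape) (there (∈-last mid b))
      toParent : ∀ {v} → R m v ⊎ R v m → v ∈ zs → v ≡ parent m
      toParent (inj₁ r) v∈ with edge-to-parent r
      ... | inj₁ (e , _) = e
      ... | inj₂ (_ , lt) = ⊥-elim (<⇒≱ lt (maximal (zs⊆ v∈)))
      toParent (inj₂ r) v∈ with edge-to-parent r
      ... | inj₂ (e , _) = e
      ... | inj₁ (_ , lt) = ⊥-elim (<⇒≱ lt (maximal (zs⊆ v∈)))

module Segments where

  open import Data.Nat using (ℕ; zero; suc; _+_; _≤_; _<_; z≤n; s≤s; pred)
  open import Data.Nat.Properties
    using (≤-refl; ≤-trans; ≤-total; ≤-antisym; <⇒≱; m≤m+n; m≤n+m; ≤-pred; +-suc; +-identityʳ;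
           n≤0⇒n≡0; pred-mono-≤; m≤n⇒m≤1+n; ≤∧≢⇒<; _≟_)
  open import Data.Bool using (Bool; true; false; if_then_else_; _∧_)
  open import Data.Bool.Properties using (∧-conicalˡ; ∧-conicalʳ)
  open import Data.Product using (∃-syntax; _×_; _,_; proj₁)
  open import Data.Sum using (_⊎_; inj₁; inj₂)
  open import Data.Empty using (⊥-elim)
  open import Relation.Nullary using (¬_; yes; no)
  open import Relation.Binary.PropositionalEquality using (_≡_; refl; sym; trans; cong; cong₂; subst)

  SameSegment : (ℕ → Bool) → ℕ → ℕ → Set
  SameSegment x i j = ∀ k → i ≤ k → k < j → x k ≡ true

  Together : (ℕ → Bool) → ℕ → ℕ → Set
  Together x i j = (i ≤ j × SameSegment x i j) ⊎ (j ≤ i × SameSegment x j i)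

  WeightsAtMostOne : ℕ → (ℕ → ℕ) → Set
  WeightsAtMostOne q c = ∀ i → i ≤ q → c i ≤ 1

  Separated : ℕ → (ℕ → Bool) → (ℕ → ℕ) → Set
  Separated q x c = ∀ i j → i < j → j ≤ q → SameSegment x i j → c i ≡ 0 ⊎ c j ≡ 0

  Covered : ℕ → (ℕ → Bool) → (ℕ → ℕ) → Set
  Covered q x c = ∀ i → i ≤ q → ∃[ j ] (j ≤ q × 1 ≤ c j × Together x j i)

  -- On the path 0 — 1 — ⋯ — q whose edge (i, i+1) is present iff x i, with weight c i at
  -- vertex i: every segment (component) carries total weight exactly one.
  OnePerSegment : ℕ → (ℕ → Bool) → (ℕ → ℕ) → Set
  OnePerSegment q x c = WeightsAtMostOne q c × Separated q x c × Covered q x c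

  isOne : ℕ → Bool
  isOne 1 = true
  isOne _ = false

  isOne⇒≡1 : ∀ n → isOne n ≡ true → n ≡ 1
  isOne⇒≡1 1 _ = refl

  contract : (ℕ → ℕ) → ℕ → ℕ
  contract c zero = c 0 + c 1
  contract c (suc i) = c (suc (suc i))

  -- A present edge 0 is contracted, merging the weights of its ends; an absent one makes vertex 0
  -- a segment of its own, which must then have weight one.
  segmentCheck : ℕ → (ℕ → Bool) → (ℕ → ℕ) → Bool
  segmentCheck zero x c = isOne (c 0)
  segmentCheck (suc q) x c =
    if x 0 then segmentCheck q (λ i → x (suc i)) (contract c)
    else isOne (c 0) ∧ segmentCheck q (λ i → x (suc i)) (λ i → c (suc i))

  segmentCheck-cong : ∀ q x c c′ → (∀ i → c i ≡ c′ i) → segmentCheck q x c ≡ segmentCheck q x c′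
  segmentCheck-cong zero x c c′ c≗c′ = cong isOne (c≗c′ 0)
  segmentCheck-cong (suc q) x c c′ c≗c′ with x 0
  ... | true = segmentCheck-cong q (λ i → x (suc i)) (contract c) (contract c′) contract≗
    where
    contract≗ : ∀ i → contract c i ≡ contract c′ i
    contract≗ zero = cong₂ _+_ (c≗c′ 0) (c≗c′ 1)
    contract≗ (suc i) = c≗c′ (suc (suc i))
  ... | false = cong₂ _∧_ (cong isOne (c≗c′ 0))
                  (segmentCheck-cong q (λ i → x (suc i)) (λ i → c (suc i)) (λ i → c′ (suc i)) (λ i → c≗c′ (suc i)))

  private
    shift : ∀ x a b → SameSegment (λ i → x (suc i)) a b → SameSegment x (suc a) (suc b)
    shift x a b ss zero () _
    shift x a b ss (suc k) (s≤s a≤k) (s≤s k<b) = ss k a≤k k<b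

    unshift : ∀ x a b → SameSegment x (suc a) (suc b) → SameSegment (λ i → x (suc i)) a b
    unshift x a b ss k a≤k k<b = ss (suc k) (s≤s a≤k) (s≤s k<b)

    cut-at-0 : ∀ x j → x 0 ≡ false → 0 < j → ¬ SameSegment x 0 j
    cut-at-0 x j x0 0<j ss with trans (sym x0) (ss 0 z≤n 0<j)
    ... | ()

    empty : ∀ x a → SameSegment x a a
    empty x a k a≤k k<a = ⊥-elim (<⇒≱ k<a a≤k)

    one-of-sum≤1 : ∀ a b → a + b ≤ 1 → a ≡ 0 ⊎ b ≡ 0
    one-of-sum≤1 zero b _ = inj₁ refl
    one-of-sum≤1 (suc a) zero _ = inj₂ refl
    one-of-sum≤1 (suc a) (suc b) (s≤s h) with subst (_≤ 0) (+-suc a b) h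
    ... | ()


  positive-summand : ∀ a b → 1 ≤ a + b → 1 ≤ a ⊎ 1 ≤ b
  positive-summand zero b h = inj₂ h
  positive-summand (suc a) b h = inj₁ (s≤s z≤n)

  onePerSegment-zero⇒ : ∀ x c → OnePerSegment 0 x c → c 0 ≡ 1
  onePerSegment-zero⇒ x c (≤1 , _ , covered) with covered 0 z≤n
  ... | zero , _ , 1≤c0 , _ = ≤-antisym (≤1 0 z≤n) 1≤c0
  ... | suc j , () , _

  onePerSegment-zero⇐ : ∀ x c → c 0 ≡ 1 → OnePerSegment 0 x c
  onePerSegment-zero⇐ x c c0≡1 = ≤1 , separated , covered
    where
    ≤1 : WeightsAtMostOne 0 c
    ≤1 zero _ = subst (_≤ 1) (sym c0≡1) ≤-refl
    separated : Separated 0 x c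
    separated i zero () _ _
    covered : Covered 0 x c
    covered zero _ = 0 , z≤n , subst (1 ≤_) (sym c0≡1) ≤-refl , inj₁ (z≤n , empty x 0)

  module _ (q : ℕ) (x : ℕ → Bool) (c : ℕ → ℕ) (x0 : x 0 ≡ false) where
    private
      x′ : ℕ → Bool
      x′ i = x (suc i)
      c′ : ℕ → ℕ
      c′ i = c (suc i)

    cut-step⇒ : OnePerSegment (suc q) x c → c 0 ≡ 1 × OnePerSegment q x′ c′
    cut-step⇒ (≤1 , separated , covered) = c0≡1 , (λ i i≤q → ≤1 (suc i) (s≤s i≤q)) , separated′ , covered′
      where
      c0≡1 : c 0 ≡ 1
      c0≡1 with covered 0 z≤n
      ... | zero , _ , 1≤c0 , _ = ≤-antisym (≤1 0 z≤n) 1≤c0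
      ... | suc j , _ , _ , inj₁ (() , _)
      ... | suc j , _ , _ , inj₂ (_ , ss) = ⊥-elim (cut-at-0 x (suc j) x0 (s≤s z≤n) ss)
      separated′ : Separated q x′ c′
      separated′ i j i<j j≤q ss = separated (suc i) (suc j) (s≤s i<j) (s≤s j≤q) (shift x i j ss)
      covered′ : Covered q x′ c′
      covered′ i i≤q with covered (suc i) (s≤s i≤q)
      ... | zero , _ , _ , inj₁ (_ , ss) = ⊥-elim (cut-at-0 x (suc i) x0 (s≤s z≤n) ss)
      ... | zero , _ , _ , inj₂ (() , _)
      ... | suc j , j≤q , 1≤cj , inj₁ (s≤s j≤i , ss) = j , ≤-pred j≤q , 1≤cj , inj₁ (j≤i , unshift x j i ss)
      ... | suc j , j≤q , 1≤cj , inj₂ (s≤s i≤j , ss) = j , ≤-pred j≤q , 1≤cj , inj₂ (i≤j , unshift x i j ss)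

    cut-step⇐ : c 0 ≡ 1 → OnePerSegment q x′ c′ → OnePerSegment (suc q) x c
    cut-step⇐ c0≡1 (≤1′ , separated′ , covered′) = ≤1 , separated , covered
      where
      ≤1 : WeightsAtMostOne (suc q) c
      ≤1 zero _ = subst (_≤ 1) (sym c0≡1) ≤-refl
      ≤1 (suc i) (s≤s i≤q) = ≤1′ i i≤q
      separated : Separated (suc q) x c
      separated zero j 0<j _ ss = ⊥-elim (cut-at-0 x j x0 0<j ss)
      separated (suc i) (suc j) (s≤s i<j) (s≤s j≤q) ss = separated′ i j i<j j≤q (unshift x i j ss)
      covered : Covered (suc q) x c
      covered zero _ = 0 , z≤n , subst (1 ≤_) (sym c0≡1) ≤-refl , inj₁ (z≤n , empty x 0)
      covered (suc i) (s≤s i≤q) with covered′ i i≤q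
      ... | j , j≤q , 1≤cj , inj₁ (j≤i , ss) = suc j , s≤s j≤q , 1≤cj , inj₁ (s≤s j≤i , shift x j i ss)
      ... | j , j≤q , 1≤cj , inj₂ (i≤j , ss) = suc j , s≤s j≤q , 1≤cj , inj₂ (s≤s i≤j , shift x i j ss)

  module _ (q : ℕ) (x : ℕ → Bool) (c : ℕ → ℕ) (x0 : x 0 ≡ true) where
    private
      x′ : ℕ → Bool
      x′ i = x (suc i)

      -- Contracting edge 0 renames vertex u to pred u.
      lift : ∀ u v → SameSegment x′ (pred u) (pred v) → SameSegment x u v
      lift u v ss zero _ _ = x0
      lift u (suc v) ss (suc k) u≤k (s≤s k<v) = ss k (pred-mono-≤ u≤k) k<v

      lower : ∀ u v → SameSegment x u v → SameSegment x′ (pred u) (pred v)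
      lower u (suc v) ss k u≤k k<v = ss (suc k) (≤-trans (≤-suc-pred u) (s≤s u≤k)) (s≤s k<v)
        where
        ≤-suc-pred : ∀ u → u ≤ suc (pred u)
        ≤-suc-pred zero = z≤n
        ≤-suc-pred (suc u) = ≤-refl

      together-lower : ∀ u v → Together x u v → Together x′ (pred u) (pred v)
      together-lower u v (inj₁ (u≤v , ss)) = inj₁ (pred-mono-≤ u≤v , lower u v ss)
      together-lower u v (inj₂ (v≤u , ss)) = inj₂ (pred-mono-≤ v≤u , lower v u ss)

      together-lift : ∀ u v → Together x′ (pred u) (pred v) → Together x u v
      together-lift u v t with ≤-total u v
      ... | inj₁ u≤v = inj₁ (u≤v , lift u v (forward t))
        where
        forward : Together x′ (pred u) (pred v) → SameSegment x′ (pred u) (pred v)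
        forward (inj₁ (_ , ss)) = ss
        forward (inj₂ (v≤u , _)) = subst (SameSegment x′ (pred u)) (≤-antisym (pred-mono-≤ u≤v) v≤u) (empty x′ (pred u))
      ... | inj₂ v≤u = inj₂ (v≤u , lift v u (backward t))
        where
        backward : Together x′ (pred u) (pred v) → SameSegment x′ (pred v) (pred u)
        backward (inj₂ (_ , ss)) = ss
        backward (inj₁ (u≤v , _)) = subst (SameSegment x′ (pred v)) (≤-antisym (pred-mono-≤ v≤u) u≤v) (empty x′ (pred v))

      ≤-contract : ∀ u → c u ≤ contract c (pred u)
      ≤-contract zero = m≤m+n (c 0) (c 1)
      ≤-contract (suc zero) = m≤n+m (c 1) (c 0)
      ≤-contract (suc (suc u)) = ≤-refl

      contract≡0 : ∀ u → contract c (pred u) ≡ 0 → c u ≡ 0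
      contract≡0 u e = n≤0⇒n≡0 (subst (c u ≤_) e (≤-contract u))

      same-01 : SameSegment x 0 1
      same-01 zero _ _ = x0
      same-01 (suc k) _ (s≤s ())

    contract-step⇒ : OnePerSegment (suc q) x c → OnePerSegment q x′ (contract c)
    contract-step⇒ (≤1 , separated , covered) = ≤1′ , separated′ , covered′
      where
      ≤1′ : WeightsAtMostOne q (contract c)
      ≤1′ zero _ with separated 0 1 (s≤s z≤n) (s≤s z≤n) same-01
      ... | inj₁ c0≡0 rewrite c0≡0 = ≤1 1 (s≤s z≤n)
      ... | inj₂ c1≡0 rewrite c1≡0 = subst (_≤ 1) (sym (+-identityʳ (c 0))) (≤1 0 z≤n)
      ≤1′ (suc i) i≤q = ≤1 (suc (suc i)) (s≤s i≤q)
      separated′ : Separated q x′ (contract c)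
      separated′ zero (suc j) _ j≤q ss
        with separated 0 (suc (suc j)) (s≤s z≤n) (s≤s j≤q) (lift 0 (suc (suc j)) ss)
           | separated 1 (suc (suc j)) (s≤s (s≤s z≤n)) (s≤s j≤q) (lift 1 (suc (suc j)) ss)
      ... | inj₂ e | _ = inj₂ e
      ... | inj₁ _ | inj₂ e = inj₂ e
      ... | inj₁ c0≡0 | inj₁ c1≡0 rewrite c0≡0 | c1≡0 = inj₁ refl
      separated′ (suc i) (suc j) i<j j≤q ss =
        separated (suc (suc i)) (suc (suc j)) (s≤s i<j) (s≤s j≤q) (lift (suc (suc i)) (suc (suc j)) ss)
      covered′ : Covered q x′ (contract c)
      covered′ i i≤q with covered (suc i) (s≤s i≤q)
      ... | j , j≤q , 1≤cj , t = pred j , pred-mono-≤ j≤q , ≤-trans 1≤cj (≤-contract j) , together-lower j (suc i) t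

    contract-step⇐ : OnePerSegment q x′ (contract c) → OnePerSegment (suc q) x c
    contract-step⇐ (≤1′ , separated′ , covered′) = ≤1 , separated , covered
      where
      ≤1 : WeightsAtMostOne (suc q) c
      ≤1 i i≤q = ≤-trans (≤-contract i) (≤1′ (pred i) (pred-mono-≤ i≤q))
      separated : Separated (suc q) x c
      separated zero (suc zero) _ _ _ = one-of-sum≤1 (c 0) (c 1) (≤1′ 0 z≤n)
      separated zero (suc (suc j)) _ j≤q ss
        with separated′ 0 (suc j) (s≤s z≤n) (pred-mono-≤ j≤q) (lower 0 (suc (suc j)) ss)
      ... | inj₁ e = inj₁ (contract≡0 0 e)
      ... | inj₂ e = inj₂ e
      separated (suc i) (suc j) (s≤s i<j) j≤q ss
        with separated′ i j i<j (pred-mono-≤ j≤q) (lower (suc i) (suc j) ss)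
      ... | inj₁ e = inj₁ (contract≡0 (suc i) e)
      ... | inj₂ e = inj₂ (contract≡0 (suc j) e)
      covered : Covered (suc q) x c
      covered i i≤q with covered′ (pred i) (pred-mono-≤ i≤q)
      ... | suc j , j≤q , 1≤cj , t = suc (suc j) , s≤s j≤q , 1≤cj , together-lift (suc (suc j)) i t
      ... | zero , _ , 1≤c , t with positive-summand (c 0) (c 1) 1≤c
      ...   | inj₁ 1≤c0 = 0 , z≤n , 1≤c0 , together-lift 0 i t
      ...   | inj₂ 1≤c1 = 1 , s≤s z≤n , 1≤c1 , together-lift 1 i t

  segmentCheck-complete : ∀ q x c → OnePerSegment q x c → segmentCheck q x c ≡ true
  segmentCheck-complete zero x c ops rewrite onePerSegment-zero⇒ x c ops = refl
  segmentCheck-complete (suc q) x c ops with x 0 in x0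
  ... | true = segmentCheck-complete q _ _ (contract-step⇒ q x c x0 ops)
  ... | false with cut-step⇒ q x c x0 ops
  ...   | c0≡1 , ops′ rewrite c0≡1 = segmentCheck-complete q _ _ ops′

  segmentCheck-sound : ∀ q x c → segmentCheck q x c ≡ true → OnePerSegment q x c
  segmentCheck-sound zero x c ok = onePerSegment-zero⇐ x c (isOne⇒≡1 (c 0) ok)
  segmentCheck-sound (suc q) x c ok with x 0 in x0
  ... | true = contract-step⇐ q x c x0 (segmentCheck-sound q _ _ ok)
  ... | false = cut-step⇐ q x c x0 (isOne⇒≡1 (c 0) (∧-conicalˡ _ _ ok))
                  (segmentCheck-sound q _ _ (∧-conicalʳ _ _ ok))

  segmentCheck-heavy : ∀ q x c i → i ≤ q → 2 ≤ c i → segmentCheck q x c ≡ false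
  segmentCheck-heavy q x c i i≤q 2≤ci with segmentCheck q x c in ok
  ... | false = refl
  ... | true = ⊥-elim (<⇒≱ 2≤ci (proj₁ (segmentCheck-sound q x c ok) i i≤q))

  module _ (x : ℕ → Bool) where

    segmentStart : ℕ → ℕ
    segmentStart zero = zero
    segmentStart (suc i) = if x i then segmentStart i else suc i

    segmentStart-≤ : ∀ i → segmentStart i ≤ i
    segmentStart-≤ zero = z≤n
    segmentStart-≤ (suc i) with x i
    ... | true = m≤n⇒m≤1+n (segmentStart-≤ i)
    ... | false = ≤-refl

    sameSegment⇒segmentStart≡ : ∀ i j → i ≤ j → SameSegment x i j → segmentStart i ≡ segmentStart j
    sameSegment⇒segmentStart≡ i zero z≤n ss = refl
    sameSegment⇒segmentStart≡ i (suc j) i≤1+j ss with i ≟ suc j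
    ... | yes refl = refl
    ... | no i≢1+j with x j in xj
    ...   | true = sameSegment⇒segmentStart≡ i j (≤-pred (≤∧≢⇒< i≤1+j i≢1+j)) (λ k i≤k k<j → ss k i≤k (m≤n⇒m≤1+n k<j))
    ...   | false with trans (sym xj) (ss j (≤-pred (≤∧≢⇒< i≤1+j i≢1+j)) ≤-refl)
    ...     | ()

    segmentStart≡⇒sameSegment : ∀ i j → i ≤ j → segmentStart i ≡ segmentStart j → SameSegment x i j
    segmentStart≡⇒sameSegment i (suc j) i≤1+j e k i≤k k<1+j with x j in xj
    ... | false = ⊥-elim (<⇒≱ (s≤s (≤-trans i≤k (≤-pred k<1+j))) (subst (_≤ i) e (segmentStart-≤ i)))
    ... | true with k ≟ j
    ...   | yes refl = xj
    ...   | no k≢j = segmentStart≡⇒sameSegment i j (≤-trans i≤k (≤-pred k<1+j)) e k i≤k (≤∧≢⇒< (≤-pred k<1+j) k≢j)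

    segmentStart≡⇒together : ∀ i j → segmentStart i ≡ segmentStart j → Together x j i
    segmentStart≡⇒together i j e with ≤-total i j
    ... | inj₁ i≤j = inj₂ (i≤j , segmentStart≡⇒sameSegment i j i≤j e)
    ... | inj₂ j≤i = inj₁ (j≤i , segmentStart≡⇒sameSegment j i j≤i (sym e))

    together⇒segmentStart≡ : ∀ i j → Together x j i → segmentStart j ≡ segmentStart i
    together⇒segmentStart≡ i j (inj₁ (j≤i , ss)) = sameSegment⇒segmentStart≡ j i j≤i ss
    together⇒segmentStart≡ i j (inj₂ (i≤j , ss)) = sym (sameSegment⇒segmentStart≡ i j i≤j ss)

module Sums where

  open import Data.Nat using (ℕ; zero; suc; _+_; _*_)
  open import Data.Nat.Properties using (+-assoc; +-identityʳ; *-distribˡ-+; *-zeroʳ)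
  open import Data.Nat.Solver using (module +-*-Solver)
  open import Data.Fin using (Fin; zero; suc; _↑ˡ_; _↑ʳ_)
  open import Data.Vec using (Vec; []; _∷_; lookup) renaming (_++_ to _++ᵥ_)
  open import Data.Vec using () renaming (here to hereᵥ; there to thereᵥ)
  open import Data.Bool using (Bool; true; false)
  open import Data.List using (List; []; _∷_; _++_; map; length; filter; tabulate)
  import Data.List as List
  open import Data.List.Membership.Propositional using (_∈_)
  open import Data.List.Relation.Unary.Any using (here; there)
  open import Data.Fin.Subset using (Subset) renaming (_∈_ to _∈ₛ_)
  open import Data.Product using (∃-syntax; _×_; _,_)
  open import Data.Empty using (⊥-elim)
  open import Relation.Nullary using (yes; no)
  open import Relation.Unary using (Decidable)
  open import Relation.Binary.PropositionalEquality using (_≡_; refl; sym; trans; cong; cong₂; module ≡-Reasoning)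
  open import Defs using (allSubsets)
  open +-*-Solver using (solve; _:+_; _:=_)

  ∑ : {A : Set} → List A → (A → ℕ) → ℕ
  ∑ [] f = 0
  ∑ (a ∷ as) f = f a + ∑ as f

  syntax ∑ as (λ a → e) = ∑[ a ∈ as ] e

  b2n : Bool → ℕ
  b2n true = 1
  b2n false = 0

  module _ {A : Set} where

    ∑-++ : ∀ (as bs : List A) f → ∑ (as ++ bs) f ≡ ∑ as f + ∑ bs f
    ∑-++ [] bs f = refl
    ∑-++ (a ∷ as) bs f = trans (cong (f a +_) (∑-++ as bs f)) (sym (+-assoc (f a) _ _))

    ∑-cong : ∀ (as : List A) {f g : A → ℕ} → (∀ a → f a ≡ g a) → ∑ as f ≡ ∑ as g
    ∑-cong [] f≗g = refl
    ∑-cong (a ∷ as) f≗g = cong₂ _+_ (f≗g a) (∑-cong as f≗g)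

    ∑-+ : ∀ (as : List A) f g → ∑[ a ∈ as ] (f a + g a) ≡ ∑ as f + ∑ as g
    ∑-+ [] f g = refl
    ∑-+ (a ∷ as) f g rewrite ∑-+ as f g =
      solve 4 (λ a b c d → (a :+ b) :+ (c :+ d) := (a :+ c) :+ (b :+ d)) refl (f a) (g a) (∑ as f) (∑ as g)

    ∑-zero : ∀ (as : List A) f → (∀ a → f a ≡ 0) → ∑ as f ≡ 0
    ∑-zero [] f f≗0 = refl
    ∑-zero (a ∷ as) f f≗0 rewrite f≗0 a = ∑-zero as f f≗0

    ∑-*ˡ : ∀ (as : List A) k f → ∑[ a ∈ as ] (k * f a) ≡ k * ∑ as f
    ∑-*ˡ [] k f = sym (*-zeroʳ k)
    ∑-*ˡ (a ∷ as) k f = trans (cong (k * f a +_) (∑-*ˡ as k f)) (sym (*-distribˡ-+ k (f a) (∑ as f)))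

    length-filter≡∑ : ∀ {P : A → Set} (P? : Decidable P) (f : A → Bool) →
                      (∀ a → P a → f a ≡ true) → (∀ a → f a ≡ true → P a) →
                      ∀ as → length (filter P? as) ≡ ∑[ a ∈ as ] b2n (f a)
    length-filter≡∑ P? f P⇒f f⇒P [] = refl
    length-filter≡∑ P? f P⇒f f⇒P (a ∷ as) with P? a | f a in fa
    ... | yes _ | true = cong suc (length-filter≡∑ P? f P⇒f f⇒P as)
    ... | no _ | false = length-filter≡∑ P? f P⇒f f⇒P as
    ... | yes pa | false with trans (sym fa) (P⇒f a pa)
    ...   | ()
    length-filter≡∑ P? f P⇒f f⇒P (a ∷ as) | no ¬pa | true = ⊥-elim (¬pa (f⇒P a fa))

  module _ {A B : Set} where

    ∑-map : ∀ (g : A → B) (as : List A) f → ∑ (map g as) f ≡ ∑[ a ∈ as ] f (g a)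
    ∑-map g [] f = refl
    ∑-map g (a ∷ as) f = cong (f (g a) +_) (∑-map g as f)

    ∑-comm : ∀ (as : List A) (bs : List B) (f : A → B → ℕ) →
             ∑[ a ∈ as ] ∑[ b ∈ bs ] f a b ≡ ∑[ b ∈ bs ] ∑[ a ∈ as ] f a b
    ∑-comm [] bs f = sym (∑-zero bs _ (λ _ → refl))
    ∑-comm (a ∷ as) bs f =
      trans (cong (∑ bs (f a) +_) (∑-comm as bs f)) (sym (∑-+ bs (f a) (λ b → ∑[ a′ ∈ as ] f a′ b)))

  ∑-allSubsets-suc : ∀ k (f : Vec Bool (suc k) → ℕ) →
                     ∑ (allSubsets (suc k)) f ≡ ∑[ v ∈ allSubsets k ] f (true ∷ v) + ∑[ v ∈ allSubsets k ] f (false ∷ v)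
  ∑-allSubsets-suc k f = trans (∑-++ (map (true ∷_) (allSubsets k)) _ f)
                               (cong₂ _+_ (∑-map (true ∷_) (allSubsets k) f) (∑-map (false ∷_) (allSubsets k) f))

  ∑-allSubsets-+ : ∀ a b (f : Vec Bool (a + b) → ℕ) →
                   ∑ (allSubsets (a + b)) f ≡ ∑[ u ∈ allSubsets a ] ∑[ v ∈ allSubsets b ] f (u ++ᵥ v)
  ∑-allSubsets-+ zero b f = sym (+-identityʳ _)
  ∑-allSubsets-+ (suc a) b f =
    trans (∑-allSubsets-suc (a + b) f)
    (trans (cong₂ _+_ (∑-allSubsets-+ a b (λ w → f (true ∷ w))) (∑-allSubsets-+ a b (λ w → f (false ∷ w))))
    (sym (∑-allSubsets-suc a _)))

  sublists : {A : Set} → List A → List (List A)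
  sublists [] = [] ∷ []
  sublists (a ∷ as) = map (a ∷_) (sublists as) ++ sublists as

  select : {A : Set} (as : List A) → Subset (length as) → List A
  select [] [] = []
  select (a ∷ as) (true ∷ S) = a ∷ select as S
  select (a ∷ as) (false ∷ S) = select as S

  selectBy : {A : Set} {k : ℕ} → (Fin k → A) → Subset k → List A
  selectBy f [] = []
  selectBy f (true ∷ S) = f zero ∷ selectBy (λ i → f (suc i)) S
  selectBy f (false ∷ S) = selectBy (λ i → f (suc i)) S

  module _ {A : Set} where

    ∑-sublists-∷ : ∀ a (as : List A) h →
                   ∑ (sublists (a ∷ as)) h ≡ ∑[ l ∈ sublists as ] h (a ∷ l) + ∑ (sublists as) h
    ∑-sublists-∷ a as h = trans (∑-++ (map (a ∷_) (sublists as)) _ h) (cong (_+ _) (∑-map (a ∷_) (sublists as) h))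

    ∑-allSubsets-select : ∀ (as : List A) h →
                          ∑[ S ∈ allSubsets (length as) ] h (select as S) ≡ ∑ (sublists as) h
    ∑-allSubsets-select [] h = refl
    ∑-allSubsets-select (a ∷ as) h =
      trans (∑-allSubsets-suc (length as) _)
      (trans (cong₂ _+_ (∑-allSubsets-select as (λ l → h (a ∷ l))) (∑-allSubsets-select as h))
      (sym (∑-sublists-∷ a as h)))

    ∑-sublists-++ : ∀ (as bs : List A) h →
                    ∑ (sublists (as ++ bs)) h ≡ ∑[ l ∈ sublists as ] ∑[ l′ ∈ sublists bs ] h (l ++ l′)
    ∑-sublists-++ [] bs h = sym (+-identityʳ _)
    ∑-sublists-++ (a ∷ as) bs h =
      trans (∑-sublists-∷ a (as ++ bs) h)
      (trans (cong₂ _+_ (∑-sublists-++ as bs (λ l → h (a ∷ l))) (∑-sublists-++ as bs h))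
      (sym (∑-sublists-∷ a as _)))

    ∑-sublists-tabulate : ∀ {k} (f : Fin k → A) h →
                          ∑ (sublists (tabulate f)) h ≡ ∑[ S ∈ allSubsets k ] h (selectBy f S)
    ∑-sublists-tabulate {zero} f h = refl
    ∑-sublists-tabulate {suc k} f h =
      trans (∑-sublists-∷ (f zero) (tabulate (λ i → f (suc i))) h)
      (trans (cong₂ _+_ (∑-sublists-tabulate (λ i → f (suc i)) (λ l → h (f zero ∷ l)))
                        (∑-sublists-tabulate (λ i → f (suc i)) h))
      (sym (∑-allSubsets-suc k _)))

    selectBy-++ : ∀ {a b} (f : Fin (a + b) → A) (u : Subset a) (v : Subset b) →
                  selectBy f (u ++ᵥ v) ≡ selectBy (λ i → f (i ↑ˡ b)) u ++ selectBy (λ j → f (a ↑ʳ j)) v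
    selectBy-++ f [] v = refl
    selectBy-++ f (true ∷ u) v = cong (f zero ∷_) (selectBy-++ (λ i → f (suc i)) u v)
    selectBy-++ f (false ∷ u) v = selectBy-++ (λ i → f (suc i)) u v

    ∈-selectBy⁻ : ∀ {k} (f : Fin k → A) (S : Subset k) {e} → e ∈ selectBy f S →
                  ∃[ i ] (lookup S i ≡ true × e ≡ f i)
    ∈-selectBy⁻ f (true ∷ S) (here refl) = zero , refl , refl
    ∈-selectBy⁻ f (true ∷ S) (there m) with ∈-selectBy⁻ (λ i → f (suc i)) S m
    ... | i , Si , e = suc i , Si , e
    ∈-selectBy⁻ f (false ∷ S) m with ∈-selectBy⁻ (λ i → f (suc i)) S m
    ... | i , Si , e = suc i , Si , e

    ∈-selectBy⁺ : ∀ {k} (f : Fin k → A) (S : Subset k) i → lookup S i ≡ true → f i ∈ selectBy f S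
    ∈-selectBy⁺ f (true ∷ S) zero _ = here refl
    ∈-selectBy⁺ f (true ∷ S) (suc i) Si = there (∈-selectBy⁺ (λ i → f (suc i)) S i Si)
    ∈-selectBy⁺ f (false ∷ S) (suc i) Si = ∈-selectBy⁺ (λ i → f (suc i)) S i Si

    ∈-select⁺ : ∀ (as : List A) S i → i ∈ₛ S → List.lookup as i ∈ select as S
    ∈-select⁺ (a ∷ as) (true ∷ S) zero hereᵥ = here refl
    ∈-select⁺ (a ∷ as) (true ∷ S) (suc i) (thereᵥ i∈S) = there (∈-select⁺ as S i i∈S)
    ∈-select⁺ (a ∷ as) (false ∷ S) (suc i) (thereᵥ i∈S) = ∈-select⁺ as S i i∈S

    ∈-select⁻ : ∀ (as : List A) S {e} → e ∈ select as S → ∃[ i ] (i ∈ₛ S × List.lookup as i ≡ e)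
    ∈-select⁻ [] [] ()
    ∈-select⁻ (a ∷ as) (true ∷ S) (here refl) = zero , hereᵥ , refl
    ∈-select⁻ (a ∷ as) (true ∷ S) (there m) with ∈-select⁻ as S m
    ... | i , i∈S , e = suc i , thereᵥ i∈S , e
    ∈-select⁻ (a ∷ as) (false ∷ S) m with ∈-select⁻ as S m
    ... | i , i∈S , e = suc i , thereᵥ i∈S , e

    select-⊆ : ∀ (as : List A) S {e} → e ∈ select as S → e ∈ as
    select-⊆ [] [] ()
    select-⊆ (a ∷ as) (true ∷ S) (here refl) = here refl
    select-⊆ (a ∷ as) (true ∷ S) (there m) = there (select-⊆ as S m)
    select-⊆ (a ∷ as) (false ∷ S) m = there (select-⊆ as S m)

  module _ {A B : Set} where

    ∑-sublists-map : ∀ (g : A → B) (as : List A) h →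
                     ∑ (sublists (map g as)) h ≡ ∑[ l ∈ sublists as ] h (map g l)
    ∑-sublists-map g [] h = refl
    ∑-sublists-map g (a ∷ as) h =
      trans (∑-sublists-∷ (g a) (map g as) h)
      (trans (cong₂ _+_ (∑-sublists-map g as (λ l → h (g a ∷ l))) (∑-sublists-map g as h))
      (sym (∑-sublists-∷ a as _)))

  ∑∑-allSubsets-suc : ∀ m n (f : Vec Bool (suc m) → Vec Bool (suc n) → ℕ) →
    ∑[ X ∈ allSubsets (suc m) ] ∑[ Y ∈ allSubsets (suc n) ] f X Y ≡
      (∑[ X ∈ allSubsets m ] ∑[ Y ∈ allSubsets n ] f (true ∷ X) (true ∷ Y) +
       ∑[ X ∈ allSubsets m ] ∑[ Y ∈ allSubsets n ] f (true ∷ X) (false ∷ Y)) +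
      (∑[ X ∈ allSubsets m ] ∑[ Y ∈ allSubsets n ] f (false ∷ X) (true ∷ Y) +
       ∑[ X ∈ allSubsets m ] ∑[ Y ∈ allSubsets n ] f (false ∷ X) (false ∷ Y))
  ∑∑-allSubsets-suc m n f =
    trans (∑-allSubsets-suc m _) (cong₂ _+_ (splitInner true) (splitInner false))
    where
    splitInner : ∀ b → ∑[ X ∈ allSubsets m ] ∑[ Y ∈ allSubsets (suc n) ] f (b ∷ X) Y ≡
                       ∑[ X ∈ allSubsets m ] ∑[ Y ∈ allSubsets n ] f (b ∷ X) (true ∷ Y) +
                       ∑[ X ∈ allSubsets m ] ∑[ Y ∈ allSubsets n ] f (b ∷ X) (false ∷ Y)
    splitInner b = trans (∑-cong (allSubsets m) (λ X → ∑-allSubsets-suc n (f (b ∷ X))))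
                         (∑-+ (allSubsets m) (λ X → ∑[ Y ∈ allSubsets n ] f (b ∷ X) (true ∷ Y)) _)

  ∑∑-*ˡ : ∀ {A B : Set} (as : List A) (bs : List B) k (f : A → B → ℕ) →
          ∑[ a ∈ as ] ∑[ b ∈ bs ] (k * f a b) ≡ k * ∑[ a ∈ as ] ∑[ b ∈ bs ] f a b
  ∑∑-*ˡ as bs k f = trans (∑-cong as (λ a → ∑-*ˡ bs k (f a))) (∑-*ˡ as k _)

  ∑-reorder₆ : ∀ {A B C D E F : Set} (as : List A) (bs : List B) (cs : List C) (ds : List D) (es : List E) (fs : List F)
    (h : A → B → C → D → E → F → ℕ) →
    ∑[ a ∈ as ] ∑[ b ∈ bs ] ∑[ c ∈ cs ] ∑[ d ∈ ds ] ∑[ e ∈ es ] ∑[ f ∈ fs ] h a b c d e f ≡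
    ∑[ b ∈ bs ] ∑[ e ∈ es ] ∑[ c ∈ cs ] ∑[ f ∈ fs ] ∑[ a ∈ as ] ∑[ d ∈ ds ] h a b c d e f
  ∑-reorder₆ as bs cs ds es fs h = begin
    ∑[ a ∈ as ] ∑[ b ∈ bs ] ∑[ c ∈ cs ] ∑[ d ∈ ds ] ∑[ e ∈ es ] ∑[ f ∈ fs ] h a b c d e f
      ≡⟨ ∑-cong as (λ a → ∑-cong bs (λ b → ∑-cong cs (λ c → ∑-comm ds es _))) ⟩
    ∑[ a ∈ as ] ∑[ b ∈ bs ] ∑[ c ∈ cs ] ∑[ e ∈ es ] ∑[ d ∈ ds ] ∑[ f ∈ fs ] h a b c d e f
      ≡⟨ ∑-cong as (λ a → ∑-cong bs (λ b → ∑-cong cs (λ c → ∑-cong es (λ e → ∑-comm ds fs _)))) ⟩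
    ∑[ a ∈ as ] ∑[ b ∈ bs ] ∑[ c ∈ cs ] ∑[ e ∈ es ] ∑[ f ∈ fs ] ∑[ d ∈ ds ] h a b c d e f
      ≡⟨ ∑-cong as (λ a → ∑-cong bs (λ b → ∑-comm cs es _)) ⟩
    ∑[ a ∈ as ] ∑[ b ∈ bs ] ∑[ e ∈ es ] ∑[ c ∈ cs ] ∑[ f ∈ fs ] ∑[ d ∈ ds ] h a b c d e f
      ≡⟨ ∑-comm as bs _ ⟩
    ∑[ b ∈ bs ] ∑[ a ∈ as ] ∑[ e ∈ es ] ∑[ c ∈ cs ] ∑[ f ∈ fs ] ∑[ d ∈ ds ] h a b c d e f
      ≡⟨ ∑-cong bs (λ b → ∑-comm as es _) ⟩
    ∑[ b ∈ bs ] ∑[ e ∈ es ] ∑[ a ∈ as ] ∑[ c ∈ cs ] ∑[ f ∈ fs ] ∑[ d ∈ ds ] h a b c d e f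
      ≡⟨ ∑-cong bs (λ b → ∑-cong es (λ e → ∑-comm as cs _)) ⟩
    ∑[ b ∈ bs ] ∑[ e ∈ es ] ∑[ c ∈ cs ] ∑[ a ∈ as ] ∑[ f ∈ fs ] ∑[ d ∈ ds ] h a b c d e f
      ≡⟨ ∑-cong bs (λ b → ∑-cong es (λ e → ∑-cong cs (λ c → ∑-comm as fs _))) ⟩
    ∑[ b ∈ bs ] ∑[ e ∈ es ] ∑[ c ∈ cs ] ∑[ f ∈ fs ] ∑[ a ∈ as ] ∑[ d ∈ ds ] h a b c d e f ∎
    where open ≡-Reasoning

module Bits where

  open import Data.Nat using (ℕ; zero; suc; _+_; _*_; _≤_; z≤n; s≤s)
  open import Data.Nat.Properties using (≤-trans; m≤n+m; ≤-pred; +-identityʳ)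
  open import Data.Fin using (Fin; zero; suc; toℕ)
  open import Data.Fin.Properties using (suc-injective)
  open import Data.Vec using (Vec; []; _∷_; lookup)
  open import Data.Bool using (Bool; true; false; _∧_)
  open import Data.Bool.Properties using (∧-conicalˡ; ∧-conicalʳ)
  open import Data.Product using (∃-syntax; _×_; _,_)
  open import Data.Empty using (⊥-elim)
  open import Relation.Binary.PropositionalEquality using (_≡_; _≢_; refl; sym; cong)
  open Sums using (b2n)

  -- Out-of-range indices read as false.
  bitAt : ∀ {k} → Vec Bool k → ℕ → Bool
  bitAt [] _ = false
  bitAt (b ∷ bs) zero = b
  bitAt (b ∷ bs) (suc i) = bitAt bs i

  bitAt-toℕ : ∀ {k} (bs : Vec Bool k) (i : Fin k) → bitAt bs (toℕ i) ≡ lookup bs i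
  bitAt-toℕ (b ∷ bs) zero = refl
  bitAt-toℕ (b ∷ bs) (suc i) = bitAt-toℕ bs i

  b2n-∧ : ∀ u v → b2n (u ∧ v) ≡ b2n u * b2n v
  b2n-∧ true v = sym (+-identityʳ (b2n v))
  b2n-∧ false v = refl

  count : (n : ℕ) → (Fin n → Bool) → ℕ
  count zero f = 0
  count (suc n) f = b2n (f zero) + count n (λ j → f (suc j))

  count-pos⇒ : ∀ n (f : Fin n → Bool) → 1 ≤ count n f → ∃[ j ] (f j ≡ true)
  count-pos⇒ (suc n) f h with f zero in f0
  ... | true = zero , f0
  ... | false with count-pos⇒ n (λ j → f (suc j)) h
  ...   | j , fj = suc j , fj

  count-≥2⇒ : ∀ n (f : Fin n → Bool) → 2 ≤ count n f → ∃[ j ] ∃[ k ] (j ≢ k × f j ≡ true × f k ≡ true)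
  count-≥2⇒ (suc n) f h with f zero in f0
  ... | true with count-pos⇒ n (λ j → f (suc j)) (≤-pred h)
  ...   | k , fk = zero , suc k , (λ ()) , f0 , fk
  count-≥2⇒ (suc n) f h | false with count-≥2⇒ n (λ j → f (suc j)) h
  ...   | j , k , j≢k , fj , fk = suc j , suc k , (λ e → j≢k (suc-injective e)) , fj , fk

  count-pos⇐ : ∀ n (f : Fin n → Bool) j → f j ≡ true → 1 ≤ count n f
  count-pos⇐ (suc n) f zero fj rewrite fj = s≤s z≤n
  count-pos⇐ (suc n) f (suc j) fj = ≤-trans (count-pos⇐ n (λ j → f (suc j)) j fj) (m≤n+m _ (b2n (f zero)))

  count-≥2⇐ : ∀ n (f : Fin n → Bool) j k → j ≢ k → f j ≡ true → f k ≡ true → 2 ≤ count n f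
  count-≥2⇐ (suc n) f zero zero j≢k _ _ = ⊥-elim (j≢k refl)
  count-≥2⇐ (suc n) f zero (suc k) _ fj fk rewrite fj = s≤s (count-pos⇐ n (λ j → f (suc j)) k fk)
  count-≥2⇐ (suc n) f (suc j) zero _ fj fk rewrite fk = s≤s (count-pos⇐ n (λ j → f (suc j)) j fj)
  count-≥2⇐ (suc n) f (suc j) (suc k) j≢k fj fk =
    ≤-trans (count-≥2⇐ n (λ j → f (suc j)) j k (λ e → j≢k (cong suc e)) fj fk) (m≤n+m _ (b2n (f zero)))

  all : ∀ k → (Fin k → Bool) → Bool
  all zero f = true
  all (suc k) f = f zero ∧ all k (λ j → f (suc j))

  all⇒ : ∀ k f → all k f ≡ true → ∀ j → f j ≡ true
  all⇒ (suc k) f ok zero = ∧-conicalˡ _ _ ok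
  all⇒ (suc k) f ok (suc j) = all⇒ k (λ j → f (suc j)) (∧-conicalʳ _ _ ok) j

  all⇐ : ∀ k f → (∀ j → f j ≡ true) → all k f ≡ true
  all⇐ zero f _ = refl
  all⇐ (suc k) f f≡true rewrite f≡true zero = all⇐ k (λ j → f (suc j)) (λ j → f≡true (suc j))

module Counting where

  open import Data.Nat using (ℕ; zero; suc; _+_; _*_; _≤_; z≤n; s≤s; _∸_; _^_)
  open import Data.Nat.Properties using (+-assoc; +-suc; *-zeroʳ; m≤m+n; m≤n+m; ≤-refl; ≤-trans)
  open import Data.Nat.Solver using (module +-*-Solver)
  open import Data.Vec using (Vec; _∷_; lookup)
  open import Data.Bool using (Bool; true; false; _∧_; _∨_)
  open import Data.Product using (_×_; _,_)
  open import Relation.Binary.PropositionalEquality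
    using (_≡_; refl; sym; trans; cong; cong₂; subst; module ≡-Reasoning)
  open import Defs using (allSubsets; bShift; t)
  open Sums
  open Bits using (bitAt; count; all; b2n-∧)
  open Segments using (isOne; contract; segmentCheck; segmentCheck-cong; segmentCheck-heavy)
  open +-*-Solver using (solve; _:+_; _:*_; _:=_; con)
  open ≡-Reasoning

  atStart : ℕ → ℕ → ℕ
  atStart k zero = k
  atStart k (suc _) = 0

  atEnd : ℕ → ℕ → ℕ → ℕ
  atEnd zero k zero = k
  atEnd zero k (suc _) = 0
  atEnd (suc q) k zero = 0
  atEnd (suc q) k (suc j) = atEnd q k j

  atEnd-end : ∀ q k → atEnd q k q ≡ k
  atEnd-end zero k = refl
  atEnd-end (suc q) k = atEnd-end q k

  atEnd-pos⇒end : ∀ q k j → 1 ≤ atEnd q k j → j ≡ q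
  atEnd-pos⇒end zero k zero _ = refl
  atEnd-pos⇒end (suc q) k (suc j) h = cong suc (atEnd-pos⇒end q k j h)

  -- Weight of path vertex j: its apex edge, plus a at vertex 0 and σ at vertex q (the leaves at
  -- either end that are joined both to the path and to the apex).
  pathWeights : ℕ → ℕ → ℕ → (ℕ → Bool) → ℕ → ℕ
  pathWeights q a σ y j = atStart a j + b2n (y j) + atEnd q σ j

  pathCount : ℕ → ℕ → ℕ → ℕ
  pathCount q a σ =
    ∑[ X ∈ allSubsets q ] ∑[ Y ∈ allSubsets (suc q) ] b2n (segmentCheck q (bitAt X) (pathWeights q a σ (bitAt Y)))

  module _ (q a σ : ℕ) where
    private
      weights : Vec Bool (suc (suc q)) → ℕ → ℕ
      weights Y = pathWeights (suc q) a σ (bitAt Y)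

      accepted : Vec Bool (suc q) → Vec Bool (suc (suc q)) → ℕ
      accepted X Y = b2n (segmentCheck (suc q) (bitAt X) (weights Y))

      contract-weights : ∀ y₀ Y i → contract (weights (y₀ ∷ Y)) i ≡ pathWeights q (a + b2n y₀ + 0) σ (bitAt Y) i
      contract-weights y₀ Y zero = sym (+-assoc (a + b2n y₀ + 0) (b2n (bitAt Y 0)) (atEnd q σ 0))
      contract-weights y₀ Y (suc i) = refl

      drop-weights : ∀ y₀ Y i → weights (y₀ ∷ Y) (suc i) ≡ pathWeights q 0 σ (bitAt Y) i
      drop-weights y₀ Y zero = refl
      drop-weights y₀ Y (suc i) = refl

      edge₀-present : ∀ y₀ → ∑[ X ∈ allSubsets q ] ∑[ Y ∈ allSubsets (suc q) ] accepted (true ∷ X) (y₀ ∷ Y) ≡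
                             pathCount q (a + b2n y₀ + 0) σ
      edge₀-present y₀ = ∑-cong (allSubsets q) (λ X → ∑-cong (allSubsets (suc q)) (λ Y →
        cong b2n (segmentCheck-cong q (bitAt X) _ _ (contract-weights y₀ Y))))

      edge₀-absent : ∀ y₀ → ∑[ X ∈ allSubsets q ] ∑[ Y ∈ allSubsets (suc q) ] accepted (false ∷ X) (y₀ ∷ Y) ≡
                            b2n (isOne (a + b2n y₀ + 0)) * pathCount q 0 σ
      edge₀-absent y₀ =
        trans (∑-cong (allSubsets q) (λ X → ∑-cong (allSubsets (suc q)) (λ Y →
                 trans (b2n-∧ (isOne (a + b2n y₀ + 0)) _)
                       (cong (λ z → b2n (isOne (a + b2n y₀ + 0)) * b2n z)
                             (segmentCheck-cong q (bitAt X) _ _ (drop-weights y₀ Y))))))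
              (∑∑-*ˡ (allSubsets q) (allSubsets (suc q)) (b2n (isOne (a + b2n y₀ + 0))) _)

    -- Edge 0 is either present (and contracted) or absent (and vertex 0 must carry weight one).
    pathCount-suc : pathCount (suc q) a σ ≡
      (pathCount q (a + 1 + 0) σ + pathCount q (a + 0 + 0) σ) +
      (b2n (isOne (a + 1 + 0)) * pathCount q 0 σ + b2n (isOne (a + 0 + 0)) * pathCount q 0 σ)
    pathCount-suc =
      trans (∑∑-allSubsets-suc q (suc q) accepted)
            (cong₂ _+_ (cong₂ _+_ (edge₀-present true) (edge₀-present false))
                       (cong₂ _+_ (edge₀-absent true) (edge₀-absent false)))

  pathCount-heavy-start : ∀ q k σ → pathCount q (2 + k) σ ≡ 0
  pathCount-heavy-start q k σ = ∑-zero (allSubsets q) _ (λ X → ∑-zero (allSubsets (suc q)) _ (λ Y →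
    cong b2n (segmentCheck-heavy q (bitAt X) _ 0 z≤n
      (≤-trans (m≤m+n 2 k) (≤-trans (m≤m+n _ (b2n (bitAt Y 0))) (m≤m+n _ (atEnd q σ 0)))))))

  pathCount-heavy-end : ∀ q a k → pathCount q a (2 + k) ≡ 0
  pathCount-heavy-end q a k = ∑-zero (allSubsets q) _ (λ X → ∑-zero (allSubsets (suc q)) _ (λ Y →
    cong b2n (segmentCheck-heavy q (bitAt X) _ q ≤-refl
      (subst (λ z → 2 ≤ atStart a q + b2n (bitAt Y q) + z) (sym (atEnd-end q (2 + k)))
        (≤-trans (m≤m+n 2 k) (m≤n+m _ (atStart a q + b2n (bitAt Y q))))))))

  pathCount-from-0 : ∀ q σ → pathCount (suc q) 0 σ ≡ 2 * pathCount q 0 σ + pathCount q 1 σ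
  pathCount-from-0 q σ = trans (pathCount-suc q 0 σ)
    (solve 2 (λ u w → (w :+ u) :+ (con 1 :* u :+ con 0 :* u) := con 2 :* u :+ w) refl (pathCount q 0 σ) (pathCount q 1 σ))

  pathCount-from-1 : ∀ q σ → pathCount (suc q) 1 σ ≡ pathCount q 0 σ + pathCount q 1 σ
  pathCount-from-1 q σ = trans (pathCount-suc q 1 σ)
    (trans (cong (λ z → (z + pathCount q 1 σ) + (0 * pathCount q 0 σ + 1 * pathCount q 0 σ)) (pathCount-heavy-start q 0 σ))
      (solve 2 (λ u w → (con 0 :+ w) :+ (con 0 :* u :+ con 1 :* u) := u :+ w) refl (pathCount q 0 σ) (pathCount q 1 σ)))

  -- The counts for σ = 0 are those for σ = 1 advanced by half a step of the recurrence
  -- (u , w) ↦ (2u + w , u + w), whose half step is the Fibonacci step (u , w) ↦ (u + w , u).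
  pathCount-halfStep : ∀ q → pathCount q 0 0 ≡ pathCount q 0 1 + pathCount q 1 1 × pathCount q 1 0 ≡ pathCount q 0 1
  pathCount-halfStep zero = refl , refl
  pathCount-halfStep (suc q) with pathCount-halfStep q
  ... | e₀ , e₁
    rewrite pathCount-from-0 q 0 | pathCount-from-0 q 1 | pathCount-from-1 q 0 | pathCount-from-1 q 1 | e₀ | e₁ =
    solve 2 (λ u w → con 2 :* (u :+ w) :+ u := (con 2 :* u :+ w) :+ (u :+ w)) refl (pathCount q 0 1) (pathCount q 1 1) ,
    solve 2 (λ u w → (u :+ w) :+ u := con 2 :* u :+ w) refl (pathCount q 0 1) (pathCount q 1 1)

  module _ (s : ℕ) where
    private
      α β : ℕ
      α = 2 ^ s
      β = s * 2 ^ (s ∸ 1)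

    pathCount-bShift : 1 ≤ s → ∀ q →
      α * pathCount q 0 1 + β * pathCount q 1 1 ≡ bShift s (q + q) ×
      α * pathCount q 0 0 + β * pathCount q 1 0 ≡ bShift s (suc (q + q))
    pathCount-bShift 1≤s zero = solve 2 (λ a b → a :* con 1 :+ b :* con 0 := a) refl α β , bShift-1 1≤s
      where
      bShift-1 : 1 ≤ s → α * 1 + β * 1 ≡ bShift s 1
      bShift-1 (s≤s {n = s′} _) =
        solve 2 (λ P s → con 2 :* P :* con 1 :+ (con 1 :+ s) :* P :* con 1 := P :* ((con 1 :+ s) :+ con 2)) refl (2 ^ s′) s′
    pathCount-bShift 1≤s (suc q) with pathCount-bShift 1≤s q | pathCount-halfStep q
    ... | even , odd | e₀ , e₁ = even′ , odd′
      where
      u = pathCount q 0 1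
      w = pathCount q 1 1
      step : bShift s (suc (q + suc q)) ≡ bShift s (suc (q + q)) + bShift s (q + q)
      step = cong (λ z → bShift s (suc z)) (+-suc q q)
      even′ = begin
        α * pathCount (suc q) 0 1 + β * pathCount (suc q) 1 1
          ≡⟨ cong₂ (λ z z′ → α * z + β * z′) (pathCount-from-0 q 1) (pathCount-from-1 q 1) ⟩
        α * (2 * u + w) + β * (u + w)
          ≡⟨ solve 4 (λ a b u w → a :* (con 2 :* u :+ w) :+ b :* (u :+ w)
                               := (a :* (u :+ w) :+ b :* u) :+ (a :* u :+ b :* w)) refl α β u w ⟩
        (α * (u + w) + β * u) + (α * u + β * w)
          ≡⟨ cong₂ (λ z z′ → (α * z + β * z′) + (α * u + β * w)) (sym e₀) (sym e₁) ⟩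
        (α * pathCount q 0 0 + β * pathCount q 1 0) + (α * u + β * w)
          ≡⟨ cong₂ _+_ odd even ⟩
        bShift s (suc (q + q)) + bShift s (q + q)
          ≡⟨ sym step ⟩
        bShift s (suc q + suc q) ∎
      odd′ = begin
        α * pathCount (suc q) 0 0 + β * pathCount (suc q) 1 0
          ≡⟨ cong₂ (λ z z′ → α * z + β * z′) (pathCount-from-0 q 0) (pathCount-from-1 q 0) ⟩
        α * (2 * pathCount q 0 0 + pathCount q 1 0) + β * (pathCount q 0 0 + pathCount q 1 0)
          ≡⟨ cong₂ (λ z z′ → α * (2 * z + z′) + β * (z + z′)) e₀ e₁ ⟩
        α * (2 * (u + w) + u) + β * ((u + w) + u)
          ≡⟨ solve 4 (λ a b u w → a :* (con 2 :* (u :+ w) :+ u) :+ b :* ((u :+ w) :+ u)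
                               := ((a :* (u :+ w) :+ b :* u) :+ (a :* u :+ b :* w)) :+ (a :* (u :+ w) :+ b :* u)) refl α β u w ⟩
        ((α * (u + w) + β * u) + (α * u + β * w)) + (α * (u + w) + β * u)
          ≡⟨ cong₂ (λ z z′ → ((α * z + β * z′) + (α * u + β * w)) + (α * z + β * z′)) (sym e₀) (sym e₁) ⟩
        ((α * pathCount q 0 0 + β * pathCount q 1 0) + (α * u + β * w)) + (α * pathCount q 0 0 + β * pathCount q 1 0)
          ≡⟨ cong₂ _+_ (cong₂ _+_ odd even) odd ⟩
        (bShift s (suc (q + q)) + bShift s (q + q)) + bShift s (suc (q + q))
          ≡⟨ cong (λ z → bShift s (suc (suc z))) (sym (+-suc q q)) ⟩
        bShift s (suc (suc q + suc q)) ∎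

  -- A leaf is attached to its hub (E), to the apex (A), or to both; F is evaluated at the number
  -- of leaves attached to both.
  leafSum : ∀ s → (ℕ → ℕ) → ℕ
  leafSum s F = ∑[ E ∈ allSubsets s ] ∑[ A ∈ allSubsets s ]
    (b2n (all s (λ j → lookup E j ∨ lookup A j)) * F (count s (λ j → lookup E j ∧ lookup A j)))

  leafSum-suc : ∀ s F → leafSum (suc s) F ≡ (leafSum s (λ k → F (suc k)) + leafSum s F) + (leafSum s F + 0)
  leafSum-suc s F = trans (∑∑-allSubsets-suc s s _)
    (cong (λ z → (leafSum s (λ k → F (suc k)) + leafSum s F) + (leafSum s F + z))
          (∑-zero (allSubsets s) _ (λ E → ∑-zero (allSubsets s) _ (λ A → refl))))

  leafSum-closed : ∀ s F → (∀ k → F (2 + k) ≡ 0) → leafSum s F ≡ 2 ^ s * F 0 + s * 2 ^ (s ∸ 1) * F 1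
  leafSum-closed zero F _ = solve 1 (λ f → (con 1 :* f :+ con 0) :+ con 0 := con 1 :* f :+ con 0) refl (F 0)
  leafSum-closed (suc s) F vanish = begin
    leafSum (suc s) F
      ≡⟨ leafSum-suc s F ⟩
    (leafSum s (λ k → F (suc k)) + leafSum s F) + (leafSum s F + 0)
      ≡⟨ cong₂ (λ z z′ → (z + z′) + (z′ + 0))
               (leafSum-closed s (λ k → F (suc k)) (λ k → vanish (suc k))) (leafSum-closed s F vanish) ⟩
    ((P * F 1 + Q * F 2) + (P * F 0 + Q * F 1)) + ((P * F 0 + Q * F 1) + 0)
      ≡⟨ cong (λ z → ((P * F 1 + Q * z) + (P * F 0 + Q * F 1)) + ((P * F 0 + Q * F 1) + 0)) (vanish 0) ⟩
    ((P * F 1 + Q * 0) + (P * F 0 + Q * F 1)) + ((P * F 0 + Q * F 1) + 0)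
      ≡⟨ solve 4 (λ P Q f₀ f₁ → ((P :* f₁ :+ Q :* con 0) :+ (P :* f₀ :+ Q :* f₁)) :+ ((P :* f₀ :+ Q :* f₁) :+ con 0)
                             := con 2 :* P :* f₀ :+ (P :+ (Q :+ Q)) :* f₁) refl P Q (F 0) (F 1) ⟩
    2 * P * F 0 + (P + (Q + Q)) * F 1
      ≡⟨ cong (λ z → 2 * P * F 0 + (P + z) * F 1) (double s) ⟩
    2 ^ suc s * F 0 + (P + s * P) * F 1 ∎
    where
    P = 2 ^ s
    Q = s * 2 ^ (s ∸ 1)
    double : ∀ s → s * 2 ^ (s ∸ 1) + s * 2 ^ (s ∸ 1) ≡ s * 2 ^ s
    double zero = refl
    double (suc s) = solve 2 (λ s P → (con 1 :+ s) :* P :+ (con 1 :+ s) :* P := (con 1 :+ s) :* (con 2 :* P)) refl s (2 ^ s)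

  spanningCount-closed : ∀ q s₁ s₂ → 1 ≤ s₁ → 1 ≤ s₂ →
    leafSum s₁ (λ k₁ → leafSum s₂ (λ k₂ → pathCount q k₁ k₂)) ≡ t (suc q) s₁ s₂
  spanningCount-closed q s₁ (suc s₂) 1≤s₁ _ with pathCount-bShift s₁ 1≤s₁ q
  ... | even , odd = begin
    leafSum s₁ (λ k₁ → leafSum (suc s₂) (pathCount q k₁))
      ≡⟨ leafSum-closed s₁ (λ k₁ → leafSum (suc s₂) (pathCount q k₁)) outer-heavy ⟩
    α * leafSum (suc s₂) (pathCount q 0) + β * leafSum (suc s₂) (pathCount q 1)
      ≡⟨ cong₂ (λ u w → α * u + β * w) (inner 0) (inner 1) ⟩
    α * (2 * P * C₀₀ + suc s₂ * P * C₀₁) + β * (2 * P * C₁₀ + suc s₂ * P * C₁₁)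
      ≡⟨ solve 8 (λ a b P s u₀ u₁ w₀ w₁ →
                    a :* (con 2 :* P :* u₀ :+ (con 1 :+ s) :* P :* u₁) :+ b :* (con 2 :* P :* w₀ :+ (con 1 :+ s) :* P :* w₁)
                    := P :* (con 2 :* (a :* u₀ :+ b :* w₀) :+ (con 1 :+ s) :* (a :* u₁ :+ b :* w₁)))
               refl α β P s₂ C₀₀ C₀₁ C₁₀ C₁₁ ⟩
    P * (2 * (α * C₀₀ + β * C₁₀) + suc s₂ * (α * C₀₁ + β * C₁₁))
      ≡⟨ cong₂ (λ u w → P * (2 * u + suc s₂ * w)) odd even ⟩
    P * (2 * bShift s₁ (suc (q + q)) + suc s₂ * bShift s₁ (q + q))
      ≡⟨ cong (λ n → P * (2 * bShift s₁ (n ∸ 1) + suc s₂ * bShift s₁ (n ∸ 2))) (sym twice-suc) ⟩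
    t (suc q) s₁ (suc s₂) ∎
    where
    α = 2 ^ s₁
    β = s₁ * 2 ^ (s₁ ∸ 1)
    P = 2 ^ s₂
    C₀₀ = pathCount q 0 0
    C₀₁ = pathCount q 0 1
    C₁₀ = pathCount q 1 0
    C₁₁ = pathCount q 1 1
    inner : ∀ k → leafSum (suc s₂) (pathCount q k) ≡ 2 ^ suc s₂ * pathCount q k 0 + suc s₂ * 2 ^ s₂ * pathCount q k 1
    inner k = leafSum-closed (suc s₂) (pathCount q k) (pathCount-heavy-end q k)
    outer-heavy : ∀ k → leafSum (suc s₂) (pathCount q (2 + k)) ≡ 0
    outer-heavy k rewrite inner (2 + k) | pathCount-heavy-start q k 0 | pathCount-heavy-start q k 1
                        | *-zeroʳ (2 ^ suc s₂) | *-zeroʳ (suc s₂ * 2 ^ s₂) = refl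
    twice-suc : 2 * suc q ≡ suc (suc (q + q))
    twice-suc = solve 1 (λ q → con 2 :* (con 1 :+ q) := con 2 :+ (q :+ q)) refl q

module ConeOverForest {V C : Set} (_≟_ : DecidableEquality V) (apex : V)
                        (Tree : V → V → Set) (Spoke : V → Set) (comp : V → C) where

  open import Data.Nat using (_≤_; z≤n; s≤s)
  open import Data.List using (List; []; _∷_; _++_; [_]; length)
  open import Data.List.Properties using (++-assoc; length-++-sucʳ)
  open import Data.List.Relation.Unary.Linked as Linked using (Linked; [-]; _∷_)
  open import Data.List.Relation.Unary.All as All using (All; []; _∷_)
  open import Data.List.Relation.Unary.AllPairs using (_∷_)
  open import Data.List.Relation.Unary.Any using (here; there)
  open import Data.List.Membership.Propositional using (_∉_)
  open import Data.List.Relation.Binary.Subset.Propositional using (_⊆_)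
  open import Data.List.Membership.Propositional.Properties using (∈-++⁻)
  open import Data.List.Membership.DecPropositional _≟_ using (_∈?_)
  open import Data.Product using (∃-syntax; _×_; _,_; proj₁; proj₂)
  open import Data.Sum using (_⊎_; inj₁; inj₂)
  open import Data.Empty using (⊥; ⊥-elim)
  open import Relation.Nullary using (¬_; yes; no)
  open import Relation.Binary.PropositionalEquality using (_≡_; _≢_; refl; sym; trans; cong; subst)
  open import Relation.Binary.Construct.Closure.ReflexiveTransitive using (Star; ε; _◅_; _◅◅_; reverse)
  open Walks

  data ConeEdge : V → V → Set where
    forest : ∀ {u v} → Tree u v → ConeEdge u v
    spoke : ∀ {v} → Spoke v → ConeEdge apex v

  Adj : V → V → Set
  Adj u v = ConeEdge u v ⊎ ConeEdge v u

  TreeAdj : V → V → Set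
  TreeAdj u v = Tree u v ⊎ Tree v u

  SpokeInEveryComponent : Set
  SpokeInEveryComponent = ∀ v → v ≢ apex → ∃[ a ] (Spoke a × comp a ≡ comp v)

  OneSpokePerComponent : Set
  OneSpokePerComponent = ∀ {a b} → Spoke a → Spoke b → comp a ≡ comp b → a ≡ b

  module _ (tree-avoids-apex : ∀ {u v} → Tree u v → u ≢ apex × v ≢ apex)
           (spoke-avoids-apex : ∀ {v} → Spoke v → v ≢ apex)
           (forest-acyclic : ¬ Cyclic TreeAdj)
           (comp-tree : ∀ {u v} → Tree u v → comp u ≡ comp v)
           (comp-connected : ∀ {u v} → u ≢ apex → v ≢ apex → comp u ≡ comp v → Star TreeAdj u v) where

    private
      adj-sym : ∀ {u v} → Adj u v → Adj v u
      adj-sym (inj₁ e) = inj₂ e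
      adj-sym (inj₂ e) = inj₁ e

      treeAdj⇒adj : ∀ {u v} → TreeAdj u v → Adj u v
      treeAdj⇒adj (inj₁ t) = inj₁ (forest t)
      treeAdj⇒adj (inj₂ t) = inj₂ (forest t)

      treeWalk⇒walk : ∀ {u v} → Star TreeAdj u v → Star Adj u v
      treeWalk⇒walk ε = ε
      treeWalk⇒walk (r ◅ s) = treeAdj⇒adj r ◅ treeWalk⇒walk s

      adj⇒treeAdj : ∀ {u v} → u ≢ apex → v ≢ apex → Adj u v → TreeAdj u v
      adj⇒treeAdj _ _ (inj₁ (forest t)) = inj₁ t
      adj⇒treeAdj u≢ _ (inj₁ (spoke _)) = ⊥-elim (u≢ refl)
      adj⇒treeAdj _ _ (inj₂ (forest t)) = inj₂ t
      adj⇒treeAdj _ v≢ (inj₂ (spoke _)) = ⊥-elim (v≢ refl)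

      into-apex : ∀ {u} → ConeEdge u apex → ⊥
      into-apex (forest t) = proj₂ (tree-avoids-apex t) refl
      into-apex (spoke s) = spoke-avoids-apex s refl

      from-apex : ∀ {v} → Adj apex v → Spoke v
      from-apex (inj₁ (forest t)) = ⊥-elim (proj₁ (tree-avoids-apex t) refl)
      from-apex (inj₁ (spoke s)) = s
      from-apex (inj₂ e) = ⊥-elim (into-apex e)

      comp-treeAdj : ∀ {u v} → TreeAdj u v → comp u ≡ comp v
      comp-treeAdj (inj₁ t) = comp-tree t
      comp-treeAdj (inj₂ t) = sym (comp-tree t)

      comp-treeWalk : ∀ {u v} → Star TreeAdj u v → comp u ≡ comp v
      comp-treeWalk ε = refl
      comp-treeWalk (r ◅ s) = trans (comp-treeAdj r) (comp-treeWalk s)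

      treeAdj-avoids-apex : ∀ {u v} → TreeAdj u v → u ≢ apex × v ≢ apex
      treeAdj-avoids-apex (inj₁ t) = tree-avoids-apex t
      treeAdj-avoids-apex (inj₂ t) = proj₂ (tree-avoids-apex t) , proj₁ (tree-avoids-apex t)

      avoids-apex : ∀ {u v l} → Linked TreeAdj (u ∷ v ∷ l) → All (_≢ apex) (u ∷ v ∷ l)
      avoids-apex {l = []} (r ∷ [-]) = proj₁ (treeAdj-avoids-apex r) ∷ proj₂ (treeAdj-avoids-apex r) ∷ []
      avoids-apex {l = w ∷ l} (r ∷ rest) = proj₁ (treeAdj-avoids-apex r) ∷ avoids-apex rest

      ∉⇒avoids : ∀ {l} → apex ∉ l → All (_≢ apex) l
      ∉⇒avoids {[]} _ = []
      ∉⇒avoids {v ∷ l} h = (λ e → h (here (sym e))) ∷ ∉⇒avoids (λ m → h (there m))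

    spokes⇒isTree : OneSpokePerComponent → SpokeInEveryComponent → IsTree Adj
    spokes⇒isTree one every = connected , acyclic
      where
      toApex : ∀ v → Star Adj v apex
      toApex v with v ≟ apex
      ... | yes refl = ε
      ... | no v≢ with every v v≢
      ...   | a , sa , ca≡cv =
        treeWalk⇒walk (comp-connected v≢ (spoke-avoids-apex sa) (sym ca≡cv)) ◅◅ (inj₂ (spoke sa) ◅ ε)

      connected : ∀ u v → Star Adj u v
      connected u v = toApex u ◅◅ reverse adj-sym (toApex v)

      -- A cycle through the apex leaves and re-enters it along two distinct spokes joined by a
      -- forest walk; a cycle avoiding the apex lies in the forest.
      acyclic : ¬ Cyclic Adj
      acyclic (x , ys , c) with apex ∈? x ∷ ys
      ... | yes apex∈ = through-apex (rotate c apex∈)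
        where
        through-apex : ∃[ zs ] (Cycle Adj apex zs × zs ⊆ x ∷ ys) → ⊥
        through-apex (zs , c′ , _) with through c′
        ... | record { first = a ; last = b ; middle = mid ; shape = shape ; enter = enter
                     ; leave = leave ; first≢last = a≢b ; walk = walk ; x∉ys = apex∉ } =
          a≢b (one (from-apex enter) (from-apex (adj-sym leave))
                   (comp-treeWalk (linked⇒star a mid b
                     (linked-mapWith-All adj⇒treeAdj (∉⇒avoids (subst (apex ∉_) shape apex∉)) walk))))
      ... | no apex∉ = forest-acyclic (x , ys , proj₁ c , proj₁ (proj₂ c) ,
                                       linked-mapWith-All adj⇒treeAdj (∉⇒avoids apex∉′) (proj₂ (proj₂ c)))
        where
        apex∉′ : apex ∉ x ∷ ys ++ [ x ]
        apex∉′ (here e) = apex∉ (here e)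
        apex∉′ (there m) with ∈-++⁻ ys m
        ... | inj₁ m₁ = apex∉ (there m₁)
        ... | inj₂ (here e) = apex∉ (here e)

    private
      spokeOnWalk : ∀ {v} → Star Adj v apex → v ≢ apex → ∃[ a ] (Spoke a × comp a ≡ comp v)
      spokeOnWalk ε v≢ = ⊥-elim (v≢ refl)
      spokeOnWalk {v} (_◅_ {j = w} r s) v≢ with w ≟ apex
      ... | yes refl = v , from-apex (adj-sym r) , refl
      ... | no w≢ with spokeOnWalk s w≢
      ...   | a , sa , ca≡cw = a , sa , trans ca≡cw (sym (comp-treeAdj (adj⇒treeAdj v≢ w≢ r)))

    isTree⇒spokes : IsTree Adj → OneSpokePerComponent × SpokeInEveryComponent
    isTree⇒spokes (connected , acyclic) = one , every
      where
      every : SpokeInEveryComponent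
      every v v≢ = spokeOnWalk (connected v apex) v≢

      -- Two spokes into one component close a cycle through the apex.
      one : OneSpokePerComponent
      one {a} {b} sa sb ca≡cb with a ≟ b
      ... | yes a≡b = a≡b
      ... | no a≢b with simplePath _≟_ (comp-connected (spoke-avoids-apex sa) (spoke-avoids-apex sb) ca≡cb) a≢b
      ...   | l , path , unique = ⊥-elim (acyclic (apex , a ∷ l ++ [ b ] , len , apex∉ ∷ unique , cycle))
        where
        len : 2 ≤ length (a ∷ l ++ [ b ])
        len = s≤s (subst (1 ≤_) (sym (length-++-sucʳ l b [])) (s≤s z≤n))
        apex∉ : All (apex ≢_) (a ∷ l ++ [ b ])
        apex∉ = All.map (λ v≢ e → v≢ (sym e)) (avoids-apex′ l path)
          where
          avoids-apex′ : ∀ l′ → Linked TreeAdj (a ∷ l′ ++ [ b ]) → All (_≢ apex) (a ∷ l′ ++ [ b ])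
          avoids-apex′ [] p = avoids-apex p
          avoids-apex′ (_ ∷ _) p = avoids-apex p
        cycle : Linked Adj (apex ∷ (a ∷ l ++ [ b ]) ++ [ apex ])
        cycle = inj₁ (spoke sa) ∷ subst (Linked Adj) (cong (a ∷_) (sym (++-assoc l [ b ] [ apex ])))
                  (linked-join (a ∷ l) (Linked.map treeAdj⇒adj path) (inj₂ (spoke sb) ∷ [-]))

module ConeModel (q s₁ s₂ : ℕ) where

  open import Data.Nat using (zero; suc; _+_; _≤_; _<_; z≤n; s≤s; _≤?_)
  open import Data.Nat.Properties
    using (≤-refl; ≤-trans; n≤1+n; <⇒≱; <⇒≤; <-irrefl; <-cmp; ≰⇒>; n≢0⇒n>0; m≤m+n; m≤n+m; +-monoˡ-≤; +-suc; +-assoc)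
  import Data.Nat.Properties as ℕ
  import Data.Fin.Properties as Fin
  open import Data.Bool using (true; false; if_then_else_; _∧_; _∨_)
  open import Data.Bool.Properties using (∧-conicalˡ; ∧-conicalʳ)
  open import Data.Product using (∃-syntax; _×_; _,_)
  open import Data.Sum using (_⊎_; inj₁; inj₂)
  open import Data.Empty using (⊥-elim)
  open import Relation.Nullary using (¬_; yes; no)
  open import Relation.Nullary.Decidable using (recompute)
  open import Relation.Binary.Definitions using (DecidableEquality; tri<; tri≈; tri>)
  open import Relation.Binary.PropositionalEquality using (_≡_; _≢_; refl; sym; trans; cong; subst)
  open import Relation.Binary.Construct.Closure.ReflexiveTransitive using (Star; ε; _◅_; _◅◅_; reverse)
  open Walks using (IsTree; parent⇒acyclic)
  open Sums using (b2n)
  open Bits using (count; count-pos⇒; count-≥2⇒; count-pos⇐; count-≥2⇐)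
  open Segments
  open Counting using (atStart; atEnd; atEnd-end; atEnd-pos⇒end; pathWeights)

  data V : Set where
    apex : V
    path : (i : ℕ) → .(i ≤ q) → V
    leaf₁ : Fin s₁ → V
    leaf₂ : Fin s₂ → V

  _≟_ : DecidableEquality V
  apex ≟ apex = yes refl
  path i _ ≟ path j _ with i ℕ.≟ j
  ... | yes refl = yes refl
  ... | no i≢j = no λ { refl → i≢j refl }
  leaf₁ j ≟ leaf₁ k with j Fin.≟ k
  ... | yes refl = yes refl
  ... | no j≢k = no λ { refl → j≢k refl }
  leaf₂ j ≟ leaf₂ k with j Fin.≟ k
  ... | yes refl = yes refl
  ... | no j≢k = no λ { refl → j≢k refl }
  apex ≟ path _ _ = no λ ()
  apex ≟ leaf₁ _ = no λ ()
  apex ≟ leaf₂ _ = no λ ()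
  path _ _ ≟ apex = no λ ()
  path _ _ ≟ leaf₁ _ = no λ ()
  path _ _ ≟ leaf₂ _ = no λ ()
  leaf₁ _ ≟ apex = no λ ()
  leaf₁ _ ≟ path _ _ = no λ ()
  leaf₁ _ ≟ leaf₂ _ = no λ ()
  leaf₂ _ ≟ apex = no λ ()
  leaf₂ _ ≟ path _ _ = no λ ()
  leaf₂ _ ≟ leaf₁ _ = no λ ()

  -- x i: path edge (i, i+1); y i: apex edge to path vertex i; eₖ j and aₖ j: edges from the
  -- j-th leaf at end k to its hub and to the apex.
  module SpanningSubgraph (x y : ℕ → Bool) (e₁ a₁ : Fin s₁ → Bool) (e₂ a₂ : Fin s₂ → Bool) where

    data TreeEdge : V → V → Set where
      path-edge : ∀ i .(h : i ≤ q) .(h′ : suc i ≤ q) → x i ≡ true → TreeEdge (path i h) (path (suc i) h′)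
      hub₁ : ∀ j .(h : 0 ≤ q) → e₁ j ≡ true → TreeEdge (path 0 h) (leaf₁ j)
      hub₂ : ∀ j .(h : q ≤ q) → e₂ j ≡ true → TreeEdge (path q h) (leaf₂ j)

    data Spoke : V → Set where
      spoke-path : ∀ i .(h : i ≤ q) → y i ≡ true → Spoke (path i h)
      spoke₁ : ∀ j → a₁ j ≡ true → Spoke (leaf₁ j)
      spoke₂ : ∀ j → a₂ j ≡ true → Spoke (leaf₂ j)

    data Component : Set where
      segment : ℕ → Component
      lone₁ : Fin s₁ → Component
      lone₂ : Fin s₂ → Component

    segment-injective : ∀ {s t} → segment s ≡ segment t → s ≡ t
    segment-injective refl = refl

    -- The component of the apex is never consulted.
    comp : V → Component
    comp apex = segment 0
    comp (path i _) = segment (segmentStart x i)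
    comp (leaf₁ j) = if e₁ j then segment 0 else lone₁ j
    comp (leaf₂ j) = if e₂ j then segment (segmentStart x q) else lone₂ j

    open ConeOverForest _≟_ apex TreeEdge Spoke comp public

    tree-avoids-apex : ∀ {u v} → TreeEdge u v → u ≢ apex × v ≢ apex
    tree-avoids-apex (path-edge _ _ _ _) = (λ ()) , (λ ())
    tree-avoids-apex (hub₁ _ _ _) = (λ ()) , (λ ())
    tree-avoids-apex (hub₂ _ _ _) = (λ ()) , (λ ())

    spoke-avoids-apex : ∀ {v} → Spoke v → v ≢ apex
    spoke-avoids-apex (spoke-path _ _ _) ()
    spoke-avoids-apex (spoke₁ _ _) ()
    spoke-avoids-apex (spoke₂ _ _) ()

    forest-acyclic : ¬ Walks.Cyclic TreeAdj
    forest-acyclic = parent⇒acyclic parent depth edge-to-parent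
      where
      parent : V → V
      parent (path (suc i) h) = path i (≤-trans (n≤1+n i) h)
      parent (leaf₁ j) = path 0 z≤n
      parent (leaf₂ j) = path q ≤-refl
      parent v = v

      depth : V → ℕ
      depth apex = 0
      depth (path i _) = i
      depth (leaf₁ _) = 1
      depth (leaf₂ _) = suc q

      child : ∀ {u w} → TreeEdge u w → u ≡ parent w × depth u < depth w
      child (path-edge i h h′ _) = refl , ≤-refl
      child (hub₁ j h _) = refl , s≤s z≤n
      child (hub₂ j h _) = refl , ≤-refl

      edge-to-parent : ∀ {u w} → TreeAdj u w →
                       (w ≡ parent u × depth w < depth u) ⊎ (u ≡ parent w × depth u < depth w)
      edge-to-parent (inj₁ t) = inj₂ (child t)
      edge-to-parent (inj₂ t) = inj₁ (child t)

    comp-tree : ∀ {u v} → TreeEdge u v → comp u ≡ comp v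
    comp-tree (path-edge i _ _ xi) rewrite xi = refl
    comp-tree (hub₁ j _ ej) rewrite ej = refl
    comp-tree (hub₂ j _ ej) rewrite ej = refl

    private
      toSegmentStart : ∀ i .(h : i ≤ q) .(h′ : segmentStart x i ≤ q) →
                       Star TreeAdj (path i h) (path (segmentStart x i) h′)
      toSegmentStart zero h h′ = ε
      toSegmentStart (suc i) h h′ with x i in xi
      ... | true = inj₂ (path-edge i (≤-trans (n≤1+n i) h) h xi) ◅ toSegmentStart i (≤-trans (n≤1+n i) h) h′
      ... | false = ε

      -- The fallback is junk: no vertex lies in a segment starting beyond q.
      anchor : Component → V
      anchor (segment s) with s ≤? q
      ... | yes h = path s h
      ... | no _ = apex
      anchor (lone₁ j) = leaf₁ j
      anchor (lone₂ j) = leaf₂ j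

      anchor-segment : ∀ s .(h : s ≤ q) → anchor (segment s) ≡ path s h
      anchor-segment s h with s ≤? q
      ... | yes _ = refl
      ... | no s≰q = ⊥-elim (s≰q (recompute (s ≤? q) h))

      toSegmentAnchor : ∀ i .(h : i ≤ q) → Star TreeAdj (path i h) (anchor (segment (segmentStart x i)))
      toSegmentAnchor i h =
        subst (Star TreeAdj (path i h)) (sym (anchor-segment (segmentStart x i) s≤q)) (toSegmentStart i h s≤q)
        where
        s≤q : segmentStart x i ≤ q
        s≤q = ≤-trans (segmentStart-≤ x i) (recompute (i ≤? q) h)

      toAnchor : ∀ v → v ≢ apex → Star TreeAdj v (anchor (comp v))
      toAnchor apex v≢ = ⊥-elim (v≢ refl)
      toAnchor (path i h) _ = toSegmentAnchor i h
      toAnchor (leaf₁ j) _ with e₁ j in ej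
      ... | true = inj₂ (hub₁ j z≤n ej) ◅ toSegmentAnchor 0 z≤n
      ... | false = ε
      toAnchor (leaf₂ j) _ with e₂ j in ej
      ... | true = inj₂ (hub₂ j ≤-refl ej) ◅ toSegmentAnchor q ≤-refl
      ... | false = ε

    comp-connected : ∀ {u v} → u ≢ apex → v ≢ apex → comp u ≡ comp v → Star TreeAdj u v
    comp-connected {u} {v} u≢ v≢ cu≡cv =
      toAnchor u u≢ ◅◅ subst (λ w → Star TreeAdj w v) (cong anchor (sym cu≡cv)) (reverse swap (toAnchor v v≢))
      where
      swap : ∀ {u v} → TreeAdj u v → TreeAdj v u
      swap (inj₁ t) = inj₂ t
      swap (inj₂ t) = inj₁ t

    k₁ k₂ : ℕ
    k₁ = count s₁ (λ j → e₁ j ∧ a₁ j)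
    k₂ = count s₂ (λ j → e₂ j ∧ a₂ j)

    weight : ℕ → ℕ
    weight = pathWeights q k₁ k₂ y

    LeavesCovered : Set
    LeavesCovered = (∀ j → e₁ j ∨ a₁ j ≡ true) × (∀ j → e₂ j ∨ a₂ j ≡ true)

    -- The spokes counted by weight j: they all lie in the component of path vertex j.
    data SpokeAt : ℕ → V → Set where
      at-path : ∀ j .(h : j ≤ q) → y j ≡ true → SpokeAt j (path j h)
      at-leaf₁ : ∀ k → e₁ k ∧ a₁ k ≡ true → SpokeAt 0 (leaf₁ k)
      at-leaf₂ : ∀ j k → j ≡ q → e₂ k ∧ a₂ k ≡ true → SpokeAt j (leaf₂ k)

    spokeAt⇒spoke : ∀ {j a} → SpokeAt j a → Spoke a
    spokeAt⇒spoke (at-path j h yj) = spoke-path j h yj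
    spokeAt⇒spoke (at-leaf₁ k ok) = spoke₁ k (∧-conicalʳ _ _ ok)
    spokeAt⇒spoke (at-leaf₂ j k _ ok) = spoke₂ k (∧-conicalʳ _ _ ok)

    comp-spokeAt : ∀ {j a} → SpokeAt j a → comp a ≡ segment (segmentStart x j)
    comp-spokeAt (at-path j h _) = refl
    comp-spokeAt (at-leaf₁ k ok) rewrite ∧-conicalˡ (e₁ k) _ ok = refl
    comp-spokeAt (at-leaf₂ j k refl ok) rewrite ∧-conicalˡ (e₂ k) _ ok = refl

    spokeAt-≤ : ∀ {j a} → SpokeAt j a → j ≤ q
    spokeAt-≤ (at-path j h _) = recompute (j ≤? q) h
    spokeAt-≤ (at-leaf₁ k _) = z≤n
    spokeAt-≤ (at-leaf₂ j k refl _) = ≤-refl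

    spokeAt-position : ∀ {i j a} → SpokeAt i a → SpokeAt j a → i ≡ j
    spokeAt-position (at-path i _ _) (at-path .i _ _) = refl
    spokeAt-position (at-leaf₁ k _) (at-leaf₁ .k _) = refl
    spokeAt-position (at-leaf₂ i k i≡q _) (at-leaf₂ j .k j≡q _) = trans i≡q (sym j≡q)

    private
      ≤-sum₁ : ∀ a b c → a ≤ a + b + c
      ≤-sum₁ a b c = ≤-trans (m≤m+n a b) (m≤m+n (a + b) c)

      ≤-sum₂ : ∀ a b c → b ≤ a + b + c
      ≤-sum₂ a b c = ≤-trans (m≤n+m b a) (m≤m+n (a + b) c)

      ≤-sum₃ : ∀ a b c → c ≤ a + b + c
      ≤-sum₃ a b c = m≤n+m c (a + b)

      ≤-sum₁₂ : ∀ a b c → a + b ≤ a + b + c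
      ≤-sum₁₂ a b c = m≤m+n (a + b) c

      ≤-sum₂₃ : ∀ a b c → b + c ≤ a + b + c
      ≤-sum₂₃ a b c = subst (b + c ≤_) (sym (+-assoc a b c)) (m≤n+m (b + c) a)

      ≤-sum₁₃ : ∀ a b c → a + c ≤ a + b + c
      ≤-sum₁₃ a b c = +-monoˡ-≤ c (m≤m+n a b)

      2≤+ : ∀ {a b} → 1 ≤ a → 1 ≤ b → 2 ≤ a + b
      2≤+ {suc a} {suc b} _ _ = s≤s (subst (1 ≤_) (sym (+-suc a b)) (s≤s z≤n))

      k₁-pos : ∀ {k} → e₁ k ∧ a₁ k ≡ true → 1 ≤ k₁
      k₁-pos {k} = count-pos⇐ s₁ _ k

      k₂-pos : ∀ {k} → e₂ k ∧ a₂ k ≡ true → 1 ≤ k₂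
      k₂-pos {k} = count-pos⇐ s₂ _ k

    spokeAt⇒weight-pos : ∀ {j a} → SpokeAt j a → 1 ≤ weight j
    spokeAt⇒weight-pos (at-path j h yj) rewrite yj = ≤-sum₂ (atStart k₁ j) 1 (atEnd q k₂ j)
    spokeAt⇒weight-pos (at-leaf₁ k ok) = ≤-trans (k₁-pos ok) (≤-sum₁ k₁ (b2n (y 0)) (atEnd q k₂ 0))
    spokeAt⇒weight-pos (at-leaf₂ j k refl ok) rewrite atEnd-end q k₂ =
      ≤-trans (k₂-pos ok) (≤-sum₃ (atStart k₁ q) (b2n (y q)) k₂)

    private
      path-leaf₁ : ∀ {k} → y 0 ≡ true → e₁ k ∧ a₁ k ≡ true → 2 ≤ weight 0
      path-leaf₁ y0 ok rewrite y0 = ≤-trans (2≤+ (k₁-pos ok) (s≤s z≤n)) (≤-sum₁₂ k₁ 1 (atEnd q k₂ 0))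

      path-leaf₂ : ∀ {j k} → y j ≡ true → j ≡ q → e₂ k ∧ a₂ k ≡ true → 2 ≤ weight j
      path-leaf₂ {j} yj refl ok rewrite yj | atEnd-end q k₂ =
        ≤-trans (2≤+ (s≤s z≤n) (k₂-pos ok)) (≤-sum₂₃ (atStart k₁ j) 1 k₂)

      leaf₁-leaf₂ : ∀ {k k′} → 0 ≡ q → e₁ k ∧ a₁ k ≡ true → e₂ k′ ∧ a₂ k′ ≡ true → 2 ≤ weight 0
      leaf₁-leaf₂ refl ok ok′ = ≤-trans (2≤+ (k₁-pos ok) (k₂-pos ok′)) (≤-sum₁₃ k₁ (b2n (y 0)) k₂)

    two-spokesAt⇒heavy : ∀ {j a b} → SpokeAt j a → SpokeAt j b → a ≢ b → 2 ≤ weight j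
    two-spokesAt⇒heavy (at-path j _ _) (at-path .j _ _) a≢b = ⊥-elim (a≢b refl)
    two-spokesAt⇒heavy (at-path .0 _ y0) (at-leaf₁ k ok) _ = path-leaf₁ y0 ok
    two-spokesAt⇒heavy (at-leaf₁ k ok) (at-path .0 _ y0) _ = path-leaf₁ y0 ok
    two-spokesAt⇒heavy (at-path j _ yj) (at-leaf₂ .j k j≡q ok) _ = path-leaf₂ yj j≡q ok
    two-spokesAt⇒heavy (at-leaf₂ j k j≡q ok) (at-path .j _ yj) _ = path-leaf₂ yj j≡q ok
    two-spokesAt⇒heavy (at-leaf₁ k ok) (at-leaf₂ .0 k′ 0≡q ok′) _ = leaf₁-leaf₂ 0≡q ok ok′
    two-spokesAt⇒heavy (at-leaf₂ .0 k 0≡q ok) (at-leaf₁ k′ ok′) _ = leaf₁-leaf₂ 0≡q ok′ ok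
    two-spokesAt⇒heavy (at-leaf₁ k ok) (at-leaf₁ k′ ok′) a≢b =
      ≤-trans (count-≥2⇐ s₁ _ k k′ (λ e → a≢b (cong leaf₁ e)) ok ok′) (≤-sum₁ k₁ (b2n (y 0)) (atEnd q k₂ 0))
    two-spokesAt⇒heavy (at-leaf₂ j k refl ok) (at-leaf₂ .j k′ _ ok′) a≢b rewrite atEnd-end q k₂ =
      ≤-trans (count-≥2⇐ s₂ _ k k′ (λ e → a≢b (cong leaf₂ e)) ok ok′) (≤-sum₃ (atStart k₁ q) (b2n (y q)) k₂)

    private
      heavy-summand : ∀ a b → 2 ≤ a + b → 2 ≤ a ⊎ (1 ≤ a × 1 ≤ b) ⊎ 2 ≤ b
      heavy-summand zero b h = inj₂ (inj₂ h)
      heavy-summand (suc zero) zero (s≤s ())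
      heavy-summand (suc zero) (suc b) h = inj₂ (inj₁ (s≤s z≤n , s≤s z≤n))
      heavy-summand (suc (suc a)) b h = inj₁ (s≤s (s≤s z≤n))

      b2n-pos : ∀ {b} → 1 ≤ b2n b → b ≡ true
      b2n-pos {true} _ = refl

      b2n≤1 : ∀ b → b2n b ≤ 1
      b2n≤1 true = ≤-refl
      b2n≤1 false = z≤n

      start-or-path-spokeAt : ∀ j → j ≤ q → 1 ≤ atStart k₁ j + b2n (y j) →
                              ∃[ a ] (SpokeAt j a × ∀ k → a ≢ leaf₂ k)
      start-or-path-spokeAt j j≤q h with positive-summand (atStart k₁ j) (b2n (y j)) h
      ... | inj₂ yj = path j j≤q , at-path j j≤q (b2n-pos yj) , (λ _ ())
      start-or-path-spokeAt zero _ _ | inj₁ start with count-pos⇒ s₁ _ start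
      ... | k , ok = leaf₁ k , at-leaf₁ k ok , (λ _ ())

      end-spokesAt : ∀ j → 1 ≤ atEnd q k₂ j → j ≡ q × 1 ≤ k₂
      end-spokesAt j h with atEnd-pos⇒end q k₂ j h
      ... | refl = refl , subst (1 ≤_) (atEnd-end q k₂) h

    weight-pos⇒spokeAt : ∀ j → j ≤ q → 1 ≤ weight j → ∃[ a ] SpokeAt j a
    weight-pos⇒spokeAt j j≤q h with positive-summand (atStart k₁ j + b2n (y j)) (atEnd q k₂ j) h
    ... | inj₁ h′ with start-or-path-spokeAt j j≤q h′
    ...   | a , at , _ = a , at
    weight-pos⇒spokeAt j j≤q h | inj₂ end with end-spokesAt j end
    ...   | j≡q , 1≤k₂ with count-pos⇒ s₂ _ 1≤k₂
    ...     | k , ok = leaf₂ k , at-leaf₂ j k j≡q ok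

    private
      start-pos : ∀ j → 1 ≤ atStart k₁ j → j ≡ 0 × 1 ≤ k₁
      start-pos zero h = refl , h

      start-heavy : ∀ j → 2 ≤ atStart k₁ j → j ≡ 0 × 2 ≤ k₁
      start-heavy zero h = refl , h

      two-leaf₂-spokesAt : ∀ j → 2 ≤ atEnd q k₂ j → ∃[ a ] ∃[ b ] (SpokeAt j a × SpokeAt j b × a ≢ b)
      two-leaf₂-spokesAt j h with end-spokesAt j (≤-trans (s≤s z≤n) h)
      ... | refl , _ with count-≥2⇒ s₂ _ (subst (2 ≤_) (atEnd-end q k₂) h)
      ...   | k , k′ , k≢k′ , ok , ok′ =
        leaf₂ k , leaf₂ k′ , at-leaf₂ q k refl ok , at-leaf₂ q k′ refl ok′ , λ { refl → k≢k′ refl }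

    weight-heavy⇒two-spokesAt : ∀ j → j ≤ q → 2 ≤ weight j → ∃[ a ] ∃[ b ] (SpokeAt j a × SpokeAt j b × a ≢ b)
    weight-heavy⇒two-spokesAt j j≤q h with heavy-summand (atStart k₁ j + b2n (y j)) (atEnd q k₂ j) h
    ... | inj₂ (inj₂ end) = two-leaf₂-spokesAt j end
    ... | inj₂ (inj₁ (h′ , end)) with start-or-path-spokeAt j j≤q h′ | end-spokesAt j end
    ...   | a , at , a≢leaf₂ | j≡q , 1≤k₂ with count-pos⇒ s₂ _ 1≤k₂
    ...     | k , ok = a , leaf₂ k , at , at-leaf₂ j k j≡q ok , a≢leaf₂ k
    weight-heavy⇒two-spokesAt j j≤q h | inj₁ h′ with heavy-summand (atStart k₁ j) (b2n (y j)) h′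
    ... | inj₂ (inj₂ y-heavy) = ⊥-elim (<⇒≱ y-heavy (b2n≤1 (y j)))
    ... | inj₂ (inj₁ (start , yj)) with start-pos j start
    ...   | refl , 1≤k₁ with count-pos⇒ s₁ _ 1≤k₁
    ...     | k , ok = leaf₁ k , path 0 z≤n , at-leaf₁ k ok , at-path 0 z≤n (b2n-pos yj) , (λ ())
    weight-heavy⇒two-spokesAt j j≤q h | inj₁ h′ | inj₁ start with start-heavy j start
    ... | refl , 2≤k₁ with count-≥2⇒ s₁ _ 2≤k₁
    ...   | k , k′ , k≢k′ , ok , ok′ =
      leaf₁ k , leaf₁ k′ , at-leaf₁ k ok , at-leaf₁ k′ ok′ , λ { refl → k≢k′ refl }

    data LoneSpoke : V → Set where
      lone-leaf₁ : ∀ k → e₁ k ≡ false → a₁ k ≡ true → LoneSpoke (leaf₁ k)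
      lone-leaf₂ : ∀ k → e₂ k ≡ false → a₂ k ≡ true → LoneSpoke (leaf₂ k)

    classify : ∀ {a} → Spoke a → (∃[ j ] SpokeAt j a) ⊎ LoneSpoke a
    classify (spoke-path i h yi) = inj₁ (i , at-path i h yi)
    classify (spoke₁ k ak) with e₁ k in ek
    ... | true = inj₁ (0 , at-leaf₁ k (subst (λ b → b ∧ a₁ k ≡ true) (sym ek) ak))
    ... | false = inj₂ (lone-leaf₁ k ek ak)
    classify (spoke₂ k ak) with e₂ k in ek
    ... | true = inj₁ (q , at-leaf₂ q k refl (subst (λ b → b ∧ a₂ k ≡ true) (sym ek) ak))
    ... | false = inj₂ (lone-leaf₂ k ek ak)

    private
      lone-not-segment : ∀ {a s} → LoneSpoke a → comp a ≢ segment s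
      lone-not-segment (lone-leaf₁ k ek _) rewrite ek = λ ()
      lone-not-segment (lone-leaf₂ k ek _) rewrite ek = λ ()

      spokeAt-lone-apart : ∀ {j a b} → SpokeAt j a → LoneSpoke b → comp a ≢ comp b
      spokeAt-lone-apart at lone ca≡cb = lone-not-segment lone (trans (sym ca≡cb) (comp-spokeAt at))

      lone-unique : ∀ {a b} → LoneSpoke a → LoneSpoke b → comp a ≡ comp b → a ≡ b
      lone-unique (lone-leaf₁ k ek _) (lone-leaf₁ k′ ek′ _) e rewrite ek | ek′ with e
      ... | refl = refl
      lone-unique (lone-leaf₁ k ek _) (lone-leaf₂ k′ ek′ _) e rewrite ek | ek′ with e
      ... | ()
      lone-unique (lone-leaf₂ k ek _) (lone-leaf₁ k′ ek′ _) e rewrite ek | ek′ with e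
      ... | ()
      lone-unique (lone-leaf₂ k ek _) (lone-leaf₂ k′ ek′ _) e rewrite ek | ek′ with e
      ... | refl = refl

      spoke-in-lone₁ : ∀ {a j} → Spoke a → comp a ≡ lone₁ j → a₁ j ≡ true
      spoke-in-lone₁ (spoke-path _ _ _) ()
      spoke-in-lone₁ (spoke₁ k ak) e with e₁ k
      spoke-in-lone₁ (spoke₁ k ak) () | true
      spoke-in-lone₁ (spoke₁ k ak) refl | false = ak
      spoke-in-lone₁ (spoke₂ k _) e with e₂ k
      spoke-in-lone₁ (spoke₂ k _) () | true
      spoke-in-lone₁ (spoke₂ k _) () | false

      spoke-in-lone₂ : ∀ {a j} → Spoke a → comp a ≡ lone₂ j → a₂ j ≡ true
      spoke-in-lone₂ (spoke-path _ _ _) ()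
      spoke-in-lone₂ (spoke₁ k _) e with e₁ k
      spoke-in-lone₂ (spoke₁ k _) () | true
      spoke-in-lone₂ (spoke₁ k _) () | false
      spoke-in-lone₂ (spoke₂ k ak) e with e₂ k
      spoke-in-lone₂ (spoke₂ k ak) () | true
      spoke-in-lone₂ (spoke₂ k ak) refl | false = ak

    every⇒leavesCovered : SpokeInEveryComponent → LeavesCovered
    every⇒leavesCovered every = covered₁ , covered₂
      where
      covered₁ : ∀ j → e₁ j ∨ a₁ j ≡ true
      covered₁ j with e₁ j in ej
      ... | true = refl
      ... | false with every (leaf₁ j) (λ ())
      ...   | a , sa , ca≡cj = spoke-in-lone₁ sa (subst (comp a ≡_) (cong (λ b → if b then _ else _) ej) ca≡cj)

      covered₂ : ∀ j → e₂ j ∨ a₂ j ≡ true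
      covered₂ j with e₂ j in ej
      ... | true = refl
      ... | false with every (leaf₂ j) (λ ())
      ...   | a , sa , ca≡cj = spoke-in-lone₂ sa (subst (comp a ≡_) (cong (λ b → if b then _ else _) ej) ca≡cj)

    every⇒covered : SpokeInEveryComponent → Covered q x weight
    every⇒covered every i i≤q with every (path i i≤q) (λ ())
    ... | a , sa , ca≡ci with classify sa
    ...   | inj₁ (j , at) = j , spokeAt-≤ at , spokeAt⇒weight-pos at ,
                            segmentStart≡⇒together x i j (segment-injective (trans (sym ca≡ci) (comp-spokeAt at)))
    ...   | inj₂ lone = ⊥-elim (lone-not-segment lone ca≡ci)

    one⇒weightsAtMostOne : OneSpokePerComponent → WeightsAtMostOne q weight
    one⇒weightsAtMostOne one i i≤q with weight i ≤? 1
    ... | yes w≤1 = w≤1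
    ... | no w≰1 with weight-heavy⇒two-spokesAt i i≤q (≰⇒> w≰1)
    ...   | a , b , at , bt , a≢b =
      ⊥-elim (a≢b (one (spokeAt⇒spoke at) (spokeAt⇒spoke bt) (trans (comp-spokeAt at) (sym (comp-spokeAt bt)))))

    one⇒separated : OneSpokePerComponent → Separated q x weight
    one⇒separated one i j i<j j≤q ss with weight i ℕ.≟ 0 | weight j ℕ.≟ 0
    ... | yes wi≡0 | _ = inj₁ wi≡0
    ... | no _ | yes wj≡0 = inj₂ wj≡0
    ... | no wi≢0 | no wj≢0
      with weight-pos⇒spokeAt i (≤-trans (<⇒≤ i<j) j≤q) (n≢0⇒n>0 wi≢0)
         | weight-pos⇒spokeAt j j≤q (n≢0⇒n>0 wj≢0)
    ...   | a , at | b , bt with one (spokeAt⇒spoke at) (spokeAt⇒spoke bt)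
              (trans (comp-spokeAt at)
                (trans (cong segment (sameSegment⇒segmentStart≡ x i j (<⇒≤ i<j) ss)) (sym (comp-spokeAt bt))))
    ...     | refl = ⊥-elim (<-irrefl (spokeAt-position at bt) i<j)

    spokes⇒segments : OneSpokePerComponent → SpokeInEveryComponent → LeavesCovered × OnePerSegment q x weight
    spokes⇒segments one every =
      every⇒leavesCovered every , one⇒weightsAtMostOne one , one⇒separated one , every⇒covered every

    segments⇒every : LeavesCovered → Covered q x weight → SpokeInEveryComponent
    segments⇒every (covered₁ , covered₂) covered = every
      where
      segment-spoke : ∀ i .(h : i ≤ q) → ∃[ a ] (Spoke a × comp a ≡ segment (segmentStart x i))
      segment-spoke i h with covered i (recompute (i ≤? q) h)
      ... | j , j≤q , 1≤wj , t with weight-pos⇒spokeAt j j≤q 1≤wj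
      ...   | a , at = a , spokeAt⇒spoke at , trans (comp-spokeAt at) (cong segment (together⇒segmentStart≡ x i j t))

      every : SpokeInEveryComponent
      every apex v≢ = ⊥-elim (v≢ refl)
      every (path i h) _ = segment-spoke i h
      every (leaf₁ k) _ with e₁ k in ek
      ... | true = segment-spoke 0 z≤n
      ... | false = leaf₁ k , spoke₁ k (subst (λ b → b ∨ a₁ k ≡ true) ek (covered₁ k)) ,
                    cong (λ b → if b then segment 0 else lone₁ k) ek
      every (leaf₂ k) _ with e₂ k in ek
      ... | true = segment-spoke q ≤-refl
      ... | false = leaf₂ k , spoke₂ k (subst (λ b → b ∨ a₂ k ≡ true) ek (covered₂ k)) ,
                    cong (λ b → if b then segment (segmentStart x q) else lone₂ k) ek

    segments⇒one : WeightsAtMostOne q weight → Separated q x weight → OneSpokePerComponent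
    segments⇒one ≤1 separated = one
      where
      unweighted : ∀ {k c} → SpokeAt k c → weight k ≢ 0
      unweighted ct w≡0 with subst (1 ≤_) w≡0 (spokeAt⇒weight-pos ct)
      ... | ()

      apart : ∀ {i j a b} → SpokeAt i a → SpokeAt j b → i < j → comp a ≢ comp b
      apart {i} {j} at bt i<j e
        with separated i j i<j (spokeAt-≤ bt)
               (segmentStart≡⇒sameSegment x i j (<⇒≤ i<j)
                 (segment-injective (trans (sym (comp-spokeAt at)) (trans e (comp-spokeAt bt)))))
      ... | inj₁ wi≡0 = unweighted at wi≡0
      ... | inj₂ wj≡0 = unweighted bt wj≡0

      spokesAt-unique : ∀ {i j a b} → SpokeAt i a → SpokeAt j b → comp a ≡ comp b → a ≡ b
      spokesAt-unique {i} {j} {a} {b} at bt e with <-cmp i j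
      ... | tri< i<j _ _ = ⊥-elim (apart at bt i<j e)
      ... | tri> _ _ j<i = ⊥-elim (apart bt at j<i (sym e))
      ... | tri≈ _ refl _ with a ≟ b
      ...   | yes a≡b = a≡b
      ...   | no a≢b = ⊥-elim (<⇒≱ (two-spokesAt⇒heavy at bt a≢b) (≤1 i (spokeAt-≤ at)))

      one : OneSpokePerComponent
      one sa sb e with classify sa | classify sb
      ... | inj₁ (_ , at) | inj₁ (_ , bt) = spokesAt-unique at bt e
      ... | inj₁ (_ , at) | inj₂ lb = ⊥-elim (spokeAt-lone-apart at lb e)
      ... | inj₂ la | inj₁ (_ , bt) = ⊥-elim (spokeAt-lone-apart bt la (sym e))
      ... | inj₂ la | inj₂ lb = lone-unique la lb e

    segments⇒spokes : LeavesCovered → OnePerSegment q x weight → OneSpokePerComponent × SpokeInEveryComponent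
    segments⇒spokes leaves (≤1 , separated , covered) = segments⇒one ≤1 separated , segments⇒every leaves covered

    isTree⇒segments : IsTree Adj → LeavesCovered × OnePerSegment q x weight
    isTree⇒segments tree =
      let one , every = isTree⇒spokes tree-avoids-apex spoke-avoids-apex forest-acyclic comp-tree comp-connected tree
      in spokes⇒segments one every

    segments⇒isTree : LeavesCovered → OnePerSegment q x weight → IsTree Adj
    segments⇒isTree leaves ops =
      let one , every = segments⇒spokes leaves ops
      in spokes⇒isTree tree-avoids-apex spoke-avoids-apex forest-acyclic comp-tree comp-connected one every

module Encoding (q s₁ s₂ : ℕ) where

  open import Data.Nat using (zero; suc; _+_; _*_; _≤_; z≤n; s≤s; _≤?_)
  open import Data.Nat.Properties using (≤-refl; <⇒≤)
  open import Data.Fin using (Fin; zero; suc; _↑ˡ_; _↑ʳ_; inject₁; fromℕ; toℕ; fromℕ<; splitAt; join)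
  import Data.Fin.Properties as Fin
  open import Data.Fin.Subset using (Subset)
  open import Data.Bool using (Bool; true; _∧_; _∨_)
  open import Data.Bool.Properties using (∧-conicalˡ; ∧-conicalʳ; ⇔→≡)
  open import Function.Bundles using (mk⇔)
  open import Data.Vec using (Vec; lookup) renaming (tabulate to tabulateᵥ)
  open import Data.Vec.Properties using (lookup∘tabulate)
  open import Data.List using (List; _++_; map; allFin; length; filter)
  open import Data.List.Properties using (map-tabulate)
  open import Data.List.Membership.Propositional using (_∈_)
  open import Data.List.Membership.Propositional.Properties using (∈-map⁺; ∈-map⁻; ∈-++⁺ˡ; ∈-++⁺ʳ; ∈-++⁻; ∈-allFin)
  open import Data.List.Relation.Binary.Subset.Propositional using (_⊆_)
  open import Data.Product using (_×_; _,_; ∃-syntax; proj₁; proj₂)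
  open import Data.Product.Properties using (≡-dec)
  open import Data.Sum using (_⊎_; inj₁; inj₂)
  open import Data.Empty using (⊥-elim)
  open import Function using (_∘_)
  open import Relation.Nullary using (yes; no; does)
  open import Relation.Nullary.Decidable using (recompute)
  open import Relation.Binary.Definitions using (DecidableEquality)
  open import Relation.Binary.PropositionalEquality
    using (_≡_; refl; sym; trans; cong; cong₂; subst; subst₂; module ≡-Reasoning)
  open import Relation.Unary using (Decidable)
  open import Defs using (IsSpanningTree; allSubsets; τ)
  import Defs
  open Walks using (IsTree; IsTree-transport)
  open Sums
  open Bits using (bitAt; bitAt-toℕ; count; all; all⇒; all⇐; b2n-∧)
  open Segments using (segmentCheck; segmentCheck-sound; segmentCheck-complete)
  open Counting using (leafSum; pathCount)
  open ConeModel q s₁ s₂ using (V; apex; path; leaf₁; leaf₂; module SpanningSubgraph)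

  open ≡-Reasoning

  n : ℕ
  n = suc q + s₁ + s₂

  pathV : Fin (suc q) → Fin n
  pathV i = (i ↑ˡ s₁) ↑ˡ s₂

  leafV₁ : Fin s₁ → Fin n
  leafV₁ j = (suc q ↑ʳ j) ↑ˡ s₂

  leafV₂ : Fin s₂ → Fin n
  leafV₂ j = (suc q + s₁) ↑ʳ j

  Edge : Set
  Edge = Fin (suc n) × Fin (suc n)

  lift : Fin n × Fin n → Edge
  lift (u , v) = suc u , suc v

  apexEdge : Fin n → Edge
  apexEdge v = zero , suc v

  pathEdge : Fin q → Fin n × Fin n
  pathEdge i = pathV (inject₁ i) , pathV (suc i)

  hubEdge₁ : Fin s₁ → Fin n × Fin n
  hubEdge₁ j = pathV zero , leafV₁ j

  hubEdge₂ : Fin s₂ → Fin n × Fin n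
  hubEdge₂ j = pathV (fromℕ q) , leafV₂ j

  treeEdges : List (Fin n × Fin n)
  treeEdges = map pathEdge (allFin q) ++ map hubEdge₁ (allFin s₁) ++ map hubEdge₂ (allFin s₂)

  -- Definitionally Cone (BiCoconut (suc q) s₁ s₂ _).
  coneEdges : List Edge
  coneEdges = map lift treeEdges ++ map apexEdge (allFin n)

  data EdgeKind : Set where
    pathE : Fin q → EdgeKind
    hubE₁ : Fin s₁ → EdgeKind
    hubE₂ : Fin s₂ → EdgeKind
    spokeE : Fin (suc q) → EdgeKind
    spokeE₁ : Fin s₁ → EdgeKind
    spokeE₂ : Fin s₂ → EdgeKind

  edgeOf : EdgeKind → Edge
  edgeOf (pathE i) = lift (pathEdge i)
  edgeOf (hubE₁ j) = lift (hubEdge₁ j)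
  edgeOf (hubE₂ j) = lift (hubEdge₂ j)
  edgeOf (spokeE i) = apexEdge (pathV i)
  edgeOf (spokeE₁ j) = apexEdge (leafV₁ j)
  edgeOf (spokeE₂ j) = apexEdge (leafV₂ j)

  -- Present path edges (X), leaf-to-hub edges (E₁, E₂), and apex edges to the path (Y) and to
  -- the leaves (A₁, A₂).
  record Selection : Set where
    constructor selection
    field
      X : Subset q
      E₁ : Subset s₁
      E₂ : Subset s₂
      Y : Subset (suc q)
      A₁ : Subset s₁
      A₂ : Subset s₂

  selected : Selection → EdgeKind → Bool
  selected b (pathE i) = lookup (Selection.X b) i
  selected b (hubE₁ j) = lookup (Selection.E₁ b) j
  selected b (hubE₂ j) = lookup (Selection.E₂ b) j
  selected b (spokeE i) = lookup (Selection.Y b) i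
  selected b (spokeE₁ j) = lookup (Selection.A₁ b) j
  selected b (spokeE₂ j) = lookup (Selection.A₂ b) j

  selectedTreeEdges : Selection → List (Fin n × Fin n)
  selectedTreeEdges b = selectBy pathEdge X ++ (selectBy hubEdge₁ E₁ ++ selectBy hubEdge₂ E₂)
    where open Selection b

  selectedSpokes : Selection → List Edge
  selectedSpokes b = (selectBy (apexEdge ∘ pathV) Y ++ selectBy (apexEdge ∘ leafV₁) A₁) ++ selectBy (apexEdge ∘ leafV₂) A₂
    where open Selection b

  edges : Selection → List Edge
  edges b = map lift (selectedTreeEdges b) ++ selectedSpokes b

  module _ (b : Selection) where
    open Selection b

    ∈-edges⁻ : ∀ {e} → e ∈ edges b → ∃[ κ ] (selected b κ ≡ true × e ≡ edgeOf κ)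
    ∈-edges⁻ m with ∈-++⁻ (map lift (selectedTreeEdges b)) m
    ... | inj₁ m-tree with ∈-map⁻ lift m-tree
    ...   | _ , m , refl = tree m
      where
      tree : ∀ {t} → t ∈ selectBy pathEdge X ++ (selectBy hubEdge₁ E₁ ++ selectBy hubEdge₂ E₂) →
             ∃[ κ ] (selected b κ ≡ true × lift t ≡ edgeOf κ)
      tree m with ∈-++⁻ (selectBy pathEdge X) m
      ... | inj₁ m′ with ∈-selectBy⁻ pathEdge X m′
      ...   | i , on , refl = pathE i , on , refl
      tree m | inj₂ m′ with ∈-++⁻ (selectBy hubEdge₁ E₁) m′
      ...   | inj₁ m″ with ∈-selectBy⁻ hubEdge₁ E₁ m″
      ...     | j , on , refl = hubE₁ j , on , refl
      tree m | inj₂ m′ | inj₂ m″ with ∈-selectBy⁻ hubEdge₂ E₂ m″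
      ...     | j , on , refl = hubE₂ j , on , refl
    ∈-edges⁻ m | inj₂ m-apex with ∈-++⁻ (selectBy (apexEdge ∘ pathV) Y ++ selectBy (apexEdge ∘ leafV₁) A₁) m-apex
    ... | inj₂ m′ with ∈-selectBy⁻ (apexEdge ∘ leafV₂) A₂ m′
    ...   | j , on , refl = spokeE₂ j , on , refl
    ∈-edges⁻ m | inj₂ m-apex | inj₁ m′ with ∈-++⁻ (selectBy (apexEdge ∘ pathV) Y) m′
    ...   | inj₁ m″ with ∈-selectBy⁻ (apexEdge ∘ pathV) Y m″
    ...     | i , on , refl = spokeE i , on , refl
    ∈-edges⁻ m | inj₂ m-apex | inj₁ m′ | inj₂ m″ with ∈-selectBy⁻ (apexEdge ∘ leafV₁) A₁ m″
    ...     | j , on , refl = spokeE₁ j , on , refl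

    ∈-edges⁺ : ∀ κ → selected b κ ≡ true → edgeOf κ ∈ edges b
    ∈-edges⁺ (pathE i) on = ∈-++⁺ˡ (∈-map⁺ lift (∈-++⁺ˡ (∈-selectBy⁺ pathEdge X i on)))
    ∈-edges⁺ (hubE₁ j) on =
      ∈-++⁺ˡ (∈-map⁺ lift (∈-++⁺ʳ (selectBy pathEdge X) (∈-++⁺ˡ (∈-selectBy⁺ hubEdge₁ E₁ j on))))
    ∈-edges⁺ (hubE₂ j) on =
      ∈-++⁺ˡ (∈-map⁺ lift (∈-++⁺ʳ (selectBy pathEdge X) (∈-++⁺ʳ (selectBy hubEdge₁ E₁) (∈-selectBy⁺ hubEdge₂ E₂ j on))))
    ∈-edges⁺ (spokeE i) on =
      ∈-++⁺ʳ (map lift (selectedTreeEdges b)) (∈-++⁺ˡ (∈-++⁺ˡ (∈-selectBy⁺ (apexEdge ∘ pathV) Y i on)))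
    ∈-edges⁺ (spokeE₁ j) on =
      ∈-++⁺ʳ (map lift (selectedTreeEdges b))
        (∈-++⁺ˡ (∈-++⁺ʳ (selectBy (apexEdge ∘ pathV) Y) (∈-selectBy⁺ (apexEdge ∘ leafV₁) A₁ j on)))
    ∈-edges⁺ (spokeE₂ j) on =
      ∈-++⁺ʳ (map lift (selectedTreeEdges b)) (∈-++⁺ʳ (selectBy (apexEdge ∘ pathV) Y ++ selectBy (apexEdge ∘ leafV₁) A₁)
                                  (∈-selectBy⁺ (apexEdge ∘ leafV₂) A₂ j on))

  private
    pathOrLeaf₁ : Fin (suc q) ⊎ Fin s₁ → V
    pathOrLeaf₁ (inj₁ i) = path (toℕ i) (Fin.toℕ≤pred[n] i)
    pathOrLeaf₁ (inj₂ j) = leaf₁ j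

    nonApex : Fin (suc q + s₁) ⊎ Fin s₂ → V
    nonApex (inj₁ w) = pathOrLeaf₁ (splitAt (suc q) w)
    nonApex (inj₂ j) = leaf₂ j

  toVertex : Fin (suc n) → V
  toVertex zero = apex
  toVertex (suc v) = nonApex (splitAt (suc q + s₁) v)

  fromVertex : V → Fin (suc n)
  fromVertex apex = zero
  fromVertex (path i h) = suc (pathV (fromℕ< (s≤s (recompute (i ≤? q) h))))
  fromVertex (leaf₁ j) = suc (leafV₁ j)
  fromVertex (leaf₂ j) = suc (leafV₂ j)

  private
    path-cong : ∀ {i j} .{h : i ≤ q} .{h′ : j ≤ q} → i ≡ j → path i h ≡ path j h′
    path-cong refl = refl

  toVertex-pathV : ∀ i → toVertex (suc (pathV i)) ≡ path (toℕ i) (Fin.toℕ≤pred[n] i)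
  toVertex-pathV i rewrite Fin.splitAt-↑ˡ (suc q + s₁) (i ↑ˡ s₁) s₂ | Fin.splitAt-↑ˡ (suc q) i s₁ = refl

  toVertex-leafV₁ : ∀ j → toVertex (suc (leafV₁ j)) ≡ leaf₁ j
  toVertex-leafV₁ j rewrite Fin.splitAt-↑ˡ (suc q + s₁) (suc q ↑ʳ j) s₂ | Fin.splitAt-↑ʳ (suc q) s₁ j = refl

  toVertex-leafV₂ : ∀ j → toVertex (suc (leafV₂ j)) ≡ leaf₂ j
  toVertex-leafV₂ j rewrite Fin.splitAt-↑ʳ (suc q + s₁) s₂ j = refl

  toVertex∘fromVertex : ∀ a → toVertex (fromVertex a) ≡ a
  toVertex∘fromVertex apex = refl
  toVertex∘fromVertex (path i h) = trans (toVertex-pathV _) (path-cong (Fin.toℕ-fromℕ< _))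
  toVertex∘fromVertex (leaf₁ j) = toVertex-leafV₁ j
  toVertex∘fromVertex (leaf₂ j) = toVertex-leafV₂ j

  fromVertex∘toVertex : ∀ u → fromVertex (toVertex u) ≡ u
  fromVertex∘toVertex zero = refl
  fromVertex∘toVertex (suc v) =
    trans (nonApex-inverse (splitAt (suc q + s₁) v)) (cong suc (Fin.join-splitAt (suc q + s₁) s₂ v))
    where
    pathOrLeaf₁-inverse : ∀ t → fromVertex (pathOrLeaf₁ t) ≡ suc (join (suc q) s₁ t ↑ˡ s₂)
    pathOrLeaf₁-inverse (inj₁ i) = cong (λ z → suc (pathV z)) (Fin.fromℕ<-toℕ i _)
    pathOrLeaf₁-inverse (inj₂ j) = refl

    nonApex-inverse : ∀ t → fromVertex (nonApex t) ≡ suc (join (suc q + s₁) s₂ t)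
    nonApex-inverse (inj₁ w) =
      trans (pathOrLeaf₁-inverse (splitAt (suc q) w)) (cong (λ z → suc (z ↑ˡ s₂)) (Fin.join-splitAt (suc q) s₁ w))
    nonApex-inverse (inj₂ j) = refl

  vertexView : ∀ (v : Fin n) → (∃[ i ] v ≡ pathV i) ⊎ (∃[ j ] v ≡ leafV₁ j) ⊎ (∃[ j ] v ≡ leafV₂ j)
  vertexView v with toVertex (suc v) | fromVertex∘toVertex (suc v)
  ... | path i h | e = inj₁ (_ , sym (Fin.suc-injective e))
  ... | leaf₁ j | e = inj₂ (inj₁ (j , sym (Fin.suc-injective e)))
  ... | leaf₂ j | e = inj₂ (inj₂ (j , sym (Fin.suc-injective e)))

  ∈-coneEdges⁻ : ∀ {e} → e ∈ coneEdges → ∃[ κ ] (e ≡ edgeOf κ)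
  ∈-coneEdges⁻ m with ∈-++⁻ (map lift treeEdges) m
  ... | inj₁ m-tree with ∈-map⁻ lift m-tree
  ...   | _ , m , refl with ∈-++⁻ (map pathEdge (allFin q)) m
  ...     | inj₁ m′ with ∈-map⁻ pathEdge m′
  ...       | i , _ , refl = pathE i , refl
  ∈-coneEdges⁻ _ | inj₁ _ | _ , _ , refl | inj₂ m′ with ∈-++⁻ (map hubEdge₁ (allFin s₁)) m′
  ...       | inj₁ m″ with ∈-map⁻ hubEdge₁ m″
  ...         | j , _ , refl = hubE₁ j , refl
  ∈-coneEdges⁻ _ | inj₁ _ | _ , _ , refl | inj₂ m′ | inj₂ m″ with ∈-map⁻ hubEdge₂ m″
  ...         | j , _ , refl = hubE₂ j , refl
  ∈-coneEdges⁻ m | inj₂ m-apex with ∈-map⁻ apexEdge m-apex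
  ... | v , _ , refl with vertexView v
  ...   | inj₁ (i , refl) = spokeE i , refl
  ...   | inj₂ (inj₁ (j , refl)) = spokeE₁ j , refl
  ...   | inj₂ (inj₂ (j , refl)) = spokeE₂ j , refl

  edges⊆coneEdges : ∀ b → edges b ⊆ coneEdges
  edges⊆coneEdges b m with ∈-edges⁻ b m
  ... | κ , _ , refl = kind∈ κ
    where
    kind∈ : ∀ κ → edgeOf κ ∈ coneEdges
    kind∈ (pathE i) = ∈-++⁺ˡ (∈-map⁺ lift (∈-++⁺ˡ (∈-map⁺ pathEdge (∈-allFin i))))
    kind∈ (hubE₁ j) = ∈-++⁺ˡ (∈-map⁺ lift (∈-++⁺ʳ (map pathEdge (allFin q)) (∈-++⁺ˡ (∈-map⁺ hubEdge₁ (∈-allFin j)))))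
    kind∈ (hubE₂ j) = ∈-++⁺ˡ (∈-map⁺ lift (∈-++⁺ʳ (map pathEdge (allFin q))
                        (∈-++⁺ʳ (map hubEdge₁ (allFin s₁)) (∈-map⁺ hubEdge₂ (∈-allFin j)))))
    kind∈ (spokeE i) = ∈-++⁺ʳ (map lift treeEdges) (∈-map⁺ apexEdge (∈-allFin (pathV i)))
    kind∈ (spokeE₁ j) = ∈-++⁺ʳ (map lift treeEdges) (∈-map⁺ apexEdge (∈-allFin (leafV₁ j)))
    kind∈ (spokeE₂ j) = ∈-++⁺ʳ (map lift treeEdges) (∈-map⁺ apexEdge (∈-allFin (leafV₂ j)))

  ListAdj : List Edge → Fin (suc n) → Fin (suc n) → Set
  ListAdj l u v = (u , v) ∈ l ⊎ (v , u) ∈ l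

  module Subgraph (b : Selection) where
    open Selection b
    open SpanningSubgraph (bitAt X) (bitAt Y) (lookup E₁) (lookup A₁) (lookup E₂) (lookup A₂) public

    kind⇒coneEdge : ∀ κ → selected b κ ≡ true → ConeEdge (toVertex (proj₁ (edgeOf κ))) (toVertex (proj₂ (edgeOf κ)))
    kind⇒coneEdge (pathE i) on =
      subst₂ ConeEdge (sym (trans (toVertex-pathV (inject₁ i)) (path-cong (Fin.toℕ-inject₁ i)))) (sym (toVertex-pathV (suc i)))
        (forest (path-edge (toℕ i) (<⇒≤ (Fin.toℕ<n i)) (Fin.toℕ<n i) (trans (bitAt-toℕ X i) on)))
    kind⇒coneEdge (hubE₁ j) on rewrite toVertex-pathV zero | toVertex-leafV₁ j = forest (hub₁ j z≤n on)
    kind⇒coneEdge (hubE₂ j) on rewrite toVertex-leafV₂ j =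
      subst (λ a → ConeEdge a (leaf₂ j)) (sym (trans (toVertex-pathV (fromℕ q)) (path-cong (Fin.toℕ-fromℕ q))))
        (forest (hub₂ j ≤-refl on))
    kind⇒coneEdge (spokeE i) on rewrite toVertex-pathV i =
      spoke (spoke-path (toℕ i) (Fin.toℕ≤pred[n] i) (trans (bitAt-toℕ Y i) on))
    kind⇒coneEdge (spokeE₁ j) on rewrite toVertex-leafV₁ j = spoke (spoke₁ j on)
    kind⇒coneEdge (spokeE₂ j) on rewrite toVertex-leafV₂ j = spoke (spoke₂ j on)

    coneEdge⇒kind : ∀ {u v} → ConeEdge u v → ∃[ κ ] (selected b κ ≡ true × edgeOf κ ≡ (fromVertex u , fromVertex v))
    coneEdge⇒kind (forest (path-edge i h h′ xi)) =
      pathE i′ , trans (sym (bitAt-toℕ X i′)) (trans (cong (bitAt X) (Fin.toℕ-fromℕ< _)) xi) ,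
      cong₂ _,_ (cong (λ z → suc (pathV z)) (Fin.toℕ-injective
                  (trans (Fin.toℕ-inject₁ i′) (trans (Fin.toℕ-fromℕ< _) (sym (Fin.toℕ-fromℕ< _))))))
                (cong (λ z → suc (pathV z)) (Fin.toℕ-injective
                  (trans (cong suc (Fin.toℕ-fromℕ< (recompute (suc i ≤? q) h′)))
                         (sym (Fin.toℕ-fromℕ< (s≤s (recompute (suc i ≤? q) h′)))))))
      where
      i′ : Fin q
      i′ = fromℕ< (recompute (suc i ≤? q) h′)
    coneEdge⇒kind (forest (hub₁ j h on)) = hubE₁ j , on , refl
    coneEdge⇒kind (forest (hub₂ j h on)) =
      hubE₂ j , on ,
      cong (λ z → suc (pathV z) , suc (leafV₂ j)) (Fin.toℕ-injective (trans (Fin.toℕ-fromℕ q) (sym (Fin.toℕ-fromℕ< _))))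
    coneEdge⇒kind (spoke (spoke-path i h on)) =
      spokeE i′ , trans (sym (bitAt-toℕ Y i′)) (trans (cong (bitAt Y) (Fin.toℕ-fromℕ< _)) on) , refl
      where
      i′ : Fin (suc q)
      i′ = fromℕ< (s≤s (recompute (i ≤? q) h))
    coneEdge⇒kind (spoke (spoke₁ j on)) = spokeE₁ j , on , refl
    coneEdge⇒kind (spoke (spoke₂ j on)) = spokeE₂ j , on , refl

    private
      listAdj⇒adj : ∀ {u v} → ListAdj (edges b) u v → Adj (toVertex u) (toVertex v)
      listAdj⇒adj (inj₁ m) with ∈-edges⁻ b m
      ... | κ , on , refl = inj₁ (kind⇒coneEdge κ on)
      listAdj⇒adj (inj₂ m) with ∈-edges⁻ b m
      ... | κ , on , refl = inj₂ (kind⇒coneEdge κ on)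

      adj⇒listAdj : ∀ {u v} → Adj u v → ListAdj (edges b) (fromVertex u) (fromVertex v)
      adj⇒listAdj (inj₁ e) with coneEdge⇒kind e
      ... | κ , on , eq = inj₁ (subst (_∈ edges b) eq (∈-edges⁺ b κ on))
      adj⇒listAdj (inj₂ e) with coneEdge⇒kind e
      ... | κ , on , eq = inj₂ (subst (_∈ edges b) eq (∈-edges⁺ b κ on))

    listTree⇒isTree : IsTree (ListAdj (edges b)) → IsTree Adj
    listTree⇒isTree = IsTree-transport toVertex fromVertex toVertex∘fromVertex listAdj⇒adj adj⇒listAdj

    isTree⇒listTree : IsTree Adj → IsTree (ListAdj (edges b))
    isTree⇒listTree = IsTree-transport fromVertex toVertex fromVertex∘toVertex adj⇒listAdj listAdj⇒adj

  leavesCovered₁ leavesCovered₂ pathAccepted : Selection → Bool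
  leavesCovered₁ b = all s₁ (λ j → lookup (Selection.E₁ b) j ∨ lookup (Selection.A₁ b) j)
  leavesCovered₂ b = all s₂ (λ j → lookup (Selection.E₂ b) j ∨ lookup (Selection.A₂ b) j)
  pathAccepted b = segmentCheck q (bitAt (Selection.X b)) (Subgraph.weight b)

  accepts : Selection → Bool
  accepts b = leavesCovered₁ b ∧ (leavesCovered₂ b ∧ pathAccepted b)

  accepts⇒listTree : ∀ b → accepts b ≡ true → IsTree (ListAdj (edges b))
  accepts⇒listTree b ok =
    Subgraph.isTree⇒listTree b (Subgraph.segments⇒isTree b
      (all⇒ s₁ _ (∧-conicalˡ (leavesCovered₁ b) _ ok) , all⇒ s₂ _ (∧-conicalˡ (leavesCovered₂ b) _ rest))
      (segmentCheck-sound q _ _ (∧-conicalʳ (leavesCovered₂ b) _ rest)))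
    where
    rest : leavesCovered₂ b ∧ pathAccepted b ≡ true
    rest = ∧-conicalʳ (leavesCovered₁ b) _ ok

  listTree⇒accepts : ∀ b → IsTree (ListAdj (edges b)) → accepts b ≡ true
  listTree⇒accepts b tree with Subgraph.isTree⇒segments b (Subgraph.listTree⇒isTree b tree)
  ... | (covered₁ , covered₂) , ops
    rewrite all⇐ s₁ _ covered₁ | all⇐ s₂ _ covered₂ = segmentCheck-complete q _ _ ops

  private
    _≟ₑ_ : DecidableEquality Edge
    _≟ₑ_ = ≡-dec Fin._≟_ Fin._≟_

    open import Data.List.Membership.DecPropositional _≟ₑ_ using (_∈?_)

    has : List Edge → EdgeKind → Bool
    has l κ = does (edgeOf κ ∈? l)

    has⇒∈ : ∀ l κ → has l κ ≡ true → edgeOf κ ∈ l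
    has⇒∈ l κ _ with edgeOf κ ∈? l
    ... | yes m = m

    ∈⇒has : ∀ l κ → edgeOf κ ∈ l → has l κ ≡ true
    ∈⇒has l κ m with edgeOf κ ∈? l
    ... | yes _ = refl
    ... | no ∉ = ⊥-elim (∉ m)

  -- accepts ∘ decode recognises the spanning trees among all sublists of coneEdges, which lets
  -- the count over edge subsets be split into a sum over selections.
  decode : List Edge → Selection
  decode l = selection (tabulateᵥ (has l ∘ pathE)) (tabulateᵥ (has l ∘ hubE₁)) (tabulateᵥ (has l ∘ hubE₂))
                       (tabulateᵥ (has l ∘ spokeE)) (tabulateᵥ (has l ∘ spokeE₁)) (tabulateᵥ (has l ∘ spokeE₂))

  private
    selected-decode : ∀ l κ → selected (decode l) κ ≡ has l κ
    selected-decode l (pathE i) = lookup∘tabulate (has l ∘ pathE) i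
    selected-decode l (hubE₁ j) = lookup∘tabulate (has l ∘ hubE₁) j
    selected-decode l (hubE₂ j) = lookup∘tabulate (has l ∘ hubE₂) j
    selected-decode l (spokeE i) = lookup∘tabulate (has l ∘ spokeE) i
    selected-decode l (spokeE₁ j) = lookup∘tabulate (has l ∘ spokeE₁) j
    selected-decode l (spokeE₂ j) = lookup∘tabulate (has l ∘ spokeE₂) j

    edges-decode⊆ : ∀ l → edges (decode l) ⊆ l
    edges-decode⊆ l m with ∈-edges⁻ (decode l) m
    ... | κ , on , refl = has⇒∈ l κ (trans (sym (selected-decode l κ)) on)

    ⊆edges-decode : ∀ l → l ⊆ coneEdges → l ⊆ edges (decode l)
    ⊆edges-decode l l⊆ m with ∈-coneEdges⁻ (l⊆ m)
    ... | κ , refl = ∈-edges⁺ (decode l) κ (trans (selected-decode l κ) (∈⇒has l κ m))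

    listTree-cong : ∀ {l l′} → l ⊆ l′ → l′ ⊆ l → IsTree (ListAdj l) → IsTree (ListAdj l′)
    listTree-cong {l} {l′} l⊆l′ l′⊆l = IsTree-transport (λ u → u) (λ u → u) (λ _ → refl) widen narrow
      where
      widen : ∀ {u v} → ListAdj l u v → ListAdj l′ u v
      widen (inj₁ m) = inj₁ (l⊆l′ m)
      widen (inj₂ m) = inj₂ (l⊆l′ m)
      narrow : ∀ {u v} → ListAdj l′ u v → ListAdj l u v
      narrow (inj₁ m) = inj₁ (l′⊆l m)
      narrow (inj₂ m) = inj₂ (l′⊆l m)

  decode-accepts⇒listTree : ∀ l → l ⊆ coneEdges → accepts (decode l) ≡ true → IsTree (ListAdj l)
  decode-accepts⇒listTree l l⊆ ok =
    listTree-cong (edges-decode⊆ l) (⊆edges-decode l l⊆) (accepts⇒listTree (decode l) ok)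

  listTree⇒decode-accepts : ∀ l → l ⊆ coneEdges → IsTree (ListAdj l) → accepts (decode l) ≡ true
  listTree⇒decode-accepts l l⊆ tree =
    listTree⇒accepts (decode l) (listTree-cong (⊆edges-decode l l⊆) (edges-decode⊆ l) tree)

  accepts-decode-edges : ∀ b → accepts (decode (edges b)) ≡ accepts b
  accepts-decode-edges b = ⇔→≡ {z = true} (mk⇔
    (λ ok → listTree⇒accepts b (decode-accepts⇒listTree (edges b) (edges⊆coneEdges b) ok))
    (λ ok → listTree⇒decode-accepts (edges b) (edges⊆coneEdges b) (accepts⇒listTree b ok)))

  private
    subsetAdj⇒listAdj : ∀ S {u v} → Defs.Adj coneEdges S u v → ListAdj (select coneEdges S) u v
    subsetAdj⇒listAdj S (i , i∈S , inj₁ e) = inj₁ (subst (_∈ select coneEdges S) e (∈-select⁺ coneEdges S i i∈S))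
    subsetAdj⇒listAdj S (i , i∈S , inj₂ e) = inj₂ (subst (_∈ select coneEdges S) e (∈-select⁺ coneEdges S i i∈S))

    listAdj⇒subsetAdj : ∀ S {u v} → ListAdj (select coneEdges S) u v → Defs.Adj coneEdges S u v
    listAdj⇒subsetAdj S (inj₁ m) with ∈-select⁻ coneEdges S m
    ... | i , i∈S , e = i , i∈S , inj₁ e
    listAdj⇒subsetAdj S (inj₂ m) with ∈-select⁻ coneEdges S m
    ... | i , i∈S , e = i , i∈S , inj₂ e

  spanningTree⇒accepts : ∀ S → IsSpanningTree coneEdges S → accepts (decode (select coneEdges S)) ≡ true
  spanningTree⇒accepts S tree =
    listTree⇒decode-accepts (select coneEdges S) (select-⊆ coneEdges S)
      (IsTree-transport (λ u → u) (λ u → u) (λ _ → refl) (subsetAdj⇒listAdj S) (listAdj⇒subsetAdj S) tree)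

  accepts⇒spanningTree : ∀ S → accepts (decode (select coneEdges S)) ≡ true → IsSpanningTree coneEdges S
  accepts⇒spanningTree S ok =
    IsTree-transport (λ u → u) (λ u → u) (λ _ → refl) (listAdj⇒subsetAdj S) (subsetAdj⇒listAdj S)
      (decode-accepts⇒listTree (select coneEdges S) (select-⊆ coneEdges S) ok)

  ∑-selections : (Selection → ℕ) → ℕ
  ∑-selections f =
    ∑[ X ∈ allSubsets q ] ∑[ E₁ ∈ allSubsets s₁ ] ∑[ E₂ ∈ allSubsets s₂ ]
    ∑[ Y ∈ allSubsets (suc q) ] ∑[ A₁ ∈ allSubsets s₁ ] ∑[ A₂ ∈ allSubsets s₂ ] f (selection X E₁ E₂ Y A₁ A₂)

  ∑-selections-cong : ∀ {f g} → (∀ b → f b ≡ g b) → ∑-selections f ≡ ∑-selections g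
  ∑-selections-cong f≗g =
    ∑-cong (allSubsets q) λ X → ∑-cong (allSubsets s₁) λ E₁ → ∑-cong (allSubsets s₂) λ E₂ →
    ∑-cong (allSubsets (suc q)) λ Y → ∑-cong (allSubsets s₁) λ A₁ → ∑-cong (allSubsets s₂) λ A₂ →
    f≗g (selection X E₁ E₂ Y A₁ A₂)

  private
    ∑-sublists-allFin : ∀ {A : Set} {k} (g : Fin k → A) h →
                        ∑ (sublists (map g (allFin k))) h ≡ ∑[ S ∈ allSubsets k ] h (selectBy g S)
    ∑-sublists-allFin g h = trans (cong (λ l → ∑ (sublists l) h) (map-tabulate (λ i → i) g)) (∑-sublists-tabulate g h)

    ∑-sublists-treeEdges : ∀ h → ∑ (sublists treeEdges) h ≡
      ∑[ X ∈ allSubsets q ] ∑[ E₁ ∈ allSubsets s₁ ] ∑[ E₂ ∈ allSubsets s₂ ]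
        h (selectBy pathEdge X ++ (selectBy hubEdge₁ E₁ ++ selectBy hubEdge₂ E₂))
    ∑-sublists-treeEdges h =
      trans (∑-sublists-++ (map pathEdge (allFin q)) _ h)
      (trans (∑-sublists-allFin pathEdge _)
      (∑-cong (allSubsets q) λ X →
        trans (∑-sublists-++ (map hubEdge₁ (allFin s₁)) _ _)
        (trans (∑-sublists-allFin hubEdge₁ _)
        (∑-cong (allSubsets s₁) λ E₁ → ∑-sublists-allFin hubEdge₂ _))))

    ∑-sublists-spokes : ∀ h → ∑ (sublists (map apexEdge (allFin n))) h ≡
      ∑[ Y ∈ allSubsets (suc q) ] ∑[ A₁ ∈ allSubsets s₁ ] ∑[ A₂ ∈ allSubsets s₂ ]
        h ((selectBy (apexEdge ∘ pathV) Y ++ selectBy (apexEdge ∘ leafV₁) A₁) ++ selectBy (apexEdge ∘ leafV₂) A₂)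
    ∑-sublists-spokes h =
      trans (∑-sublists-allFin apexEdge h)
      (trans (∑-allSubsets-+ (suc q + s₁) s₂ _)
      (trans (∑-cong (allSubsets (suc q + s₁)) (λ u → ∑-cong (allSubsets s₂) (λ v → cong h (selectBy-++ apexEdge u v))))
      (trans (∑-allSubsets-+ (suc q) s₁ _)
      (∑-cong (allSubsets (suc q)) λ Y → ∑-cong (allSubsets s₁) λ A₁ → ∑-cong (allSubsets s₂) λ A₂ →
        cong (λ l → h (l ++ selectBy (apexEdge ∘ leafV₂) A₂)) (selectBy-++ (λ i → apexEdge (i ↑ˡ s₂)) Y A₁)))))

  ∑-sublists-coneEdges : ∀ h → ∑ (sublists coneEdges) h ≡ ∑-selections (h ∘ edges)
  ∑-sublists-coneEdges h =
    trans (∑-sublists-++ (map lift treeEdges) (map apexEdge (allFin n)) h)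
    (trans (∑-sublists-map lift treeEdges _)
    (trans (∑-cong (sublists treeEdges) (λ l → ∑-sublists-spokes (λ l′ → h (map lift l ++ l′))))
    (∑-sublists-treeEdges _)))

  τ-cone : (dec : Decidable (IsSpanningTree coneEdges)) → τ coneEdges dec ≡ ∑-selections (b2n ∘ accepts)
  τ-cone dec = begin
    length (filter dec (allSubsets (length coneEdges)))
      ≡⟨ length-filter≡∑ dec (accepts ∘ decode ∘ select coneEdges) spanningTree⇒accepts accepts⇒spanningTree
                         (allSubsets (length coneEdges)) ⟩
    ∑[ S ∈ allSubsets (length coneEdges) ] b2n (accepts (decode (select coneEdges S)))
      ≡⟨ ∑-allSubsets-select coneEdges (b2n ∘ accepts ∘ decode) ⟩
    ∑ (sublists coneEdges) (b2n ∘ accepts ∘ decode)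
      ≡⟨ ∑-sublists-coneEdges (b2n ∘ accepts ∘ decode) ⟩
    ∑-selections (b2n ∘ accepts ∘ decode ∘ edges)
      ≡⟨ ∑-selections-cong (λ b → cong b2n (accepts-decode-edges b)) ⟩
    ∑-selections (b2n ∘ accepts) ∎

  ∑-accepts≡leafSums : ∑-selections (b2n ∘ accepts) ≡ leafSum s₁ (λ k₁ → leafSum s₂ (λ k₂ → pathCount q k₁ k₂))
  ∑-accepts≡leafSums = begin
    ∑-selections (b2n ∘ accepts)
      ≡⟨ ∑-selections-cong split ⟩
    ∑-selections (λ b → b2n (leavesCovered₁ b) * (b2n (leavesCovered₂ b) * b2n (pathAccepted b)))
      ≡⟨ ∑-reorder₆ (allSubsets q) (allSubsets s₁) (allSubsets s₂) (allSubsets (suc q)) (allSubsets s₁) (allSubsets s₂)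
                    (λ X E₁ E₂ Y A₁ A₂ → term (selection X E₁ E₂ Y A₁ A₂)) ⟩
    ∑[ E₁ ∈ allSubsets s₁ ] ∑[ A₁ ∈ allSubsets s₁ ] ∑[ E₂ ∈ allSubsets s₂ ] ∑[ A₂ ∈ allSubsets s₂ ]
    ∑[ X ∈ allSubsets q ] ∑[ Y ∈ allSubsets (suc q) ] term (selection X E₁ E₂ Y A₁ A₂)
      ≡⟨ (∑-cong (allSubsets s₁) λ E₁ → ∑-cong (allSubsets s₁) λ A₁ →
            trans (∑-cong (allSubsets s₂) λ E₂ → ∑-cong (allSubsets s₂) λ A₂ → factor E₁ A₁ E₂ A₂)
                  (∑∑-*ˡ (allSubsets s₂) (allSubsets s₂) (b2n (all s₁ (λ j → lookup E₁ j ∨ lookup A₁ j))) _)) ⟩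
    leafSum s₁ (λ k₁ → leafSum s₂ (λ k₂ → pathCount q k₁ k₂)) ∎
    where
    term : Selection → ℕ
    term b = b2n (leavesCovered₁ b) * (b2n (leavesCovered₂ b) * b2n (pathAccepted b))

    split : ∀ b → b2n (accepts b) ≡ term b
    split b = trans (b2n-∧ (leavesCovered₁ b) _) (cong (b2n (leavesCovered₁ b) *_) (b2n-∧ (leavesCovered₂ b) _))

    factor : ∀ E₁ A₁ E₂ A₂ →
      ∑[ X ∈ allSubsets q ] ∑[ Y ∈ allSubsets (suc q) ] term (selection X E₁ E₂ Y A₁ A₂) ≡
      b2n (all s₁ (λ j → lookup E₁ j ∨ lookup A₁ j)) * (b2n (all s₂ (λ j → lookup E₂ j ∨ lookup A₂ j)) *
        pathCount q (count s₁ (λ j → lookup E₁ j ∧ lookup A₁ j)) (count s₂ (λ j → lookup E₂ j ∧ lookup A₂ j)))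
    factor E₁ A₁ E₂ A₂ =
      trans (∑∑-*ˡ (allSubsets q) (allSubsets (suc q)) (b2n (all s₁ (λ j → lookup E₁ j ∨ lookup A₁ j))) _)
            (cong (b2n (all s₁ (λ j → lookup E₁ j ∨ lookup A₁ j)) *_)
                  (∑∑-*ˡ (allSubsets q) (allSubsets (suc q)) (b2n (all s₂ (λ j → lookup E₂ j ∨ lookup A₂ j))) _))

theorem1p1 : (p s₁ s₂ : ℕ) (hp : 1 ≤ p) → 1 ≤ s₁ → 1 ≤ s₂ →
    (dec : Decidable (IsSpanningTree (Cone (BiCoconut p s₁ s₂ hp)))) →
    τ (Cone (BiCoconut p s₁ s₂ hp)) dec ≡ t p s₁ s₂
theorem1p1 (suc q) s₁ s₂ (s≤s z≤n) 1≤s₁ 1≤s₂ dec = begin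
  τ (Cone (BiCoconut (suc q) s₁ s₂ (s≤s z≤n))) dec
    ≡⟨ τ-cone dec ⟩
  ∑-selections (b2n ∘ accepts)
    ≡⟨ ∑-accepts≡leafSums ⟩
  leafSum s₁ (λ k₁ → leafSum s₂ (λ k₂ → pathCount q k₁ k₂))
    ≡⟨ spanningCount-closed q s₁ s₂ 1≤s₁ 1≤s₂ ⟩
  t (suc q) s₁ s₂ ∎
  where
  open ≡-Reasoning
  open Sums using (b2n)
  open Counting using (leafSum; pathCount; spanningCount-closed)
  open Encoding q s₁ s₂ using (τ-cone; ∑-selections; accepts; ∑-accepts≡leafSums)
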